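{- Let $\ell\ge3$, let $\lambda$ be an $\ell$-core and $0\le i<\ell$. Then $\widehat\varphi_i(\lambda)=\varphi_i(\lambda)$ and $\widehat f_i^{\widehat\varphi_i(\lambda)}\lambda=\widetilde f_i^{\varphi_i(\lambda)}\lambda$. Consequently, every $\ell$-core is a node of $B(\Lambda_0)^L$.
   Context: An $\ell$-core is a partition none of whose hook lengths is divisible by $\ell$ (equivalently, with no removable $\ell$-rim hook); $\ell$-cores are $\ell$-regular. Young diagrams in English notation; $(a,b)$ is the box in row $a$, column $b$, residue $b-a\bmod\ell$. Removable (resp. addable) $i$-box: a box in $\lambda$ (resp. position not in $\lambda$) of residue $i$ whose removal (resp. addition) yields a partition. Ladder crystal: the ladder of $(a,b)$ is the set of positions $(c,d)$, $c,d\ge1$, with $c+(\ell-1)d=a+(\ell-1)b$; ladders are ordered left to right by increasing $c+(\ell-1)d$, within a ladder top to bottom by increasing row index. The ladder $i$-signature writes $+$ for each addable $i$-box and $-$ for each removable $i$-box, reading ladders left to right, each ladder top to bottom; repeatedly deleting adjacent "$-+$" gives $+\cdots+-\cdots-$; remaining $+$'s are ladder conormal, the rightmost being the ladder cogood $i$-box; $\widehat f_i\lambda$ adds the ladder cogood $i$-box ($0$ if none) and $\widehat\varphi_i(\lambda)$ is the number of ladder conormal $i$-boxes. Nodes of $B(\Lambda_0)^L$: partitions obtainable from $\emptyset$ by finite sequences of the $\widehat f_i$. Classical crystal: for $\ell$-regular $\lambda$, the $i$-signature writes $+$/$-$ for addable/removable $i$-boxes read in order of decreasing row index; deleting adjacent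 "$-+$" repeatedly gives $+\cdots+-\cdots-$; remaining $+$'s are conormal, the rightmost being the cogood $i$-box; $\widetilde f_i\lambda$ adds the cogood $i$-box ($0$ if none) and $\varphi_i(\lambda)$ is the number of conormal $i$-boxes. -}

module Defs where

open import Data.Nat using (ℕ; zero; suc; _+_; _*_; _∸_; _≤_; _<_; _≤ᵇ_; _≡ᵇ_)
open import Data.Nat.Divisibility using (_∣_)
open import Data.Integer as ℤ using (ℤ; +_)
open import Data.Integer.Base using (_%ℕ_)
open import Data.Bool using (Bool; true; false; _∧_; _∨_; not; if_then_else_)
open import Data.List using (List; []; _∷_; length; filter; map; concatMap; reverse; upTo; foldl)
open import Data.List.Relation.Unary.All using (All)
open import Data.List.Relation.Unary.Linked using (Linked)
open import Data.Maybe using (Maybe; just; nothing; _>>=_)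
open import Data.Product using (_×_; _,_; ∃; proj₁; proj₂)
open import Relation.Nullary using (¬_)
open import Relation.Binary.PropositionalEquality using (_≡_)

Partition : Set
Partition = List ℕ

IsPartition : Partition → Set
IsPartition λ′ = Linked (λ x y → y ≤ x) λ′ × All (λ x → 0 < x) λ′

-- row λ a = λ_a (1-indexed), 0 beyond the last row
row : Partition → ℕ → ℕ
row []      _             = 0
row (x ∷ _) 1             = x
row (_ ∷ xs) (suc (suc a)) = row xs (suc a)
row (_ ∷ _) zero          = 0

col : Partition → ℕ → ℕ
col λ′ b = length (filter (λ x → b Data.Nat.≤? x) λ′)

inDiag : Partition → ℕ → ℕ → Bool
inDiag λ′ a b = (1 ≤ᵇ a) ∧ (1 ≤ᵇ b) ∧ (b ≤ᵇ row λ′ a)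

hook : Partition → ℕ → ℕ → ℕ
hook λ′ a b = (row λ′ a ∸ b) + (col λ′ b ∸ a) + 1

IsCore : ℕ → Partition → Set
IsCore ℓ λ′ = ∀ a b → inDiag λ′ a b ≡ true → ¬ (ℓ ∣ hook λ′ a b)

res : ℕ → ℕ → ℕ → ℕ
res zero    a b = 0
res (suc m) a b = ((+ b) ℤ.- (+ a)) %ℕ (suc m)

addable : Partition → ℕ → ℕ → Bool
addable λ′ a b = (1 ≤ᵇ a) ∧ (1 ≤ᵇ b) ∧ not (inDiag λ′ a b)
                 ∧ ((a ≡ᵇ 1) ∨ inDiag λ′ (a ∸ 1) b)
                 ∧ ((b ≡ᵇ 1) ∨ inDiag λ′ a (b ∸ 1))

removable : Partition → ℕ → ℕ → Bool
removable λ′ a b = inDiag λ′ a b ∧ not (inDiag λ′ (suc a) b) ∧ not (inDiag λ′ a (suc b))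

-- add a box at the end of row a (a ≤ length λ + 1)
addRow : ℕ → Partition → Partition
addRow _             []       = 1 ∷ []
addRow 1             (x ∷ xs) = suc x ∷ xs
addRow (suc (suc a)) (x ∷ xs) = x ∷ addRow (suc a) xs
addRow zero          (x ∷ xs) = x ∷ xs

Pos : Set
Pos = ℕ × ℕ

oneTo : ℕ → List ℕ
oneTo n = map suc (upTo n)

-- the grid rows 1..len+1, columns 1..λ₁+1 contains every addable/removable box
gridR : Partition → ℕ
gridR λ′ = suc (length λ′)

gridC : Partition → ℕ
gridC λ′ = suc (row λ′ 1)

classicalOrder : Partition → List Pos
classicalOrder λ′ =
  concatMap (λ a → map (λ b → (a , b)) (oneTo (gridC λ′))) (reverse (oneTo (gridR λ′)))

ladderOrder : ℕ → Partition → List Pos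
ladderOrder ℓ λ′ =
  concatMap (λ k →
    concatMap (λ c →
      concatMap (λ d → if (c + (ℓ ∸ 1) * d) ≡ᵇ k then (c , d) ∷ [] else [])
                (oneTo (gridC λ′)))
      (oneTo (gridR λ′)))
    (oneTo (gridR λ′ + (ℓ ∸ 1) * gridC λ′))

data Sign : Set where
  plus minus : Sign

Sig : Set
Sig = List (Sign × Pos)

signature : ℕ → Partition → ℕ → List Pos → Sig
signature ℓ λ′ i = concatMap entry
  where
  entry : Pos → Sig
  entry (a , b) =
    if res ℓ a b ≡ᵇ i
    then (if addable λ′ a b then (plus , (a , b)) ∷ []
          else if removable λ′ a b then (minus , (a , b)) ∷ [] else [])
    else []

cancelStep : Sig → Sig
cancelStep []                                  = []
cancelStep ((minus , p) ∷ (plus , q) ∷ s)      = s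
cancelStep (x ∷ s)                             = x ∷ cancelStep s

iterate : ℕ → (Sig → Sig) → Sig → Sig
iterate zero    f s = s
iterate (suc n) f s = iterate n f (f s)

-- repeatedly delete adjacent "-+" (length s steps suffice)
reduce : Sig → Sig
reduce s = iterate (length s) cancelStep s

conormal : Sig → List Pos
conormal s = concatMap keep (reduce s)
  where
  keep : Sign × Pos → List Pos
  keep (plus , p)  = p ∷ []
  keep (minus , _) = []

lastM : List Pos → Maybe Pos
lastM []       = nothing
lastM (p ∷ []) = just p
lastM (_ ∷ ps) = lastM ps

addPos : Partition → Maybe Pos → Maybe Partition
addPos λ′ nothing        = nothing
addPos λ′ (just (a , b)) = just (addRow a λ′)

ladderSig : ℕ → ℕ → Partition → Sig
ladderSig ℓ i λ′ = signature ℓ λ′ i (ladderOrder ℓ λ′)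

φ̂ : ℕ → ℕ → Partition → ℕ
φ̂ ℓ i λ′ = length (conormal (ladderSig ℓ i λ′))

f̂ : ℕ → ℕ → Partition → Maybe Partition
f̂ ℓ i λ′ = addPos λ′ (lastM (conormal (ladderSig ℓ i λ′)))

classSig : ℕ → ℕ → Partition → Sig
classSig ℓ i λ′ = signature ℓ λ′ i (classicalOrder λ′)

φ : ℕ → ℕ → Partition → ℕ
φ ℓ i λ′ = length (conormal (classSig ℓ i λ′))

f̃ : ℕ → ℕ → Partition → Maybe Partition
f̃ ℓ i λ′ = addPos λ′ (lastM (conormal (classSig ℓ i λ′)))

_^[_]_ : (Partition → Maybe Partition) → ℕ → Maybe Partition → Maybe Partition
g ^[ zero ]  m = m
g ^[ suc n ] m = g ^[ n ] (m >>= g)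

applyF̂ : ℕ → List ℕ → Maybe Partition → Maybe Partition
applyF̂ ℓ []       m = m
applyF̂ ℓ (i ∷ is) m = applyF̂ ℓ is (m >>= f̂ ℓ i)

-- nodes of B(Λ₀)^L: reachable from ∅ by finitely many f̂_i, 0 ≤ i < ℓ
NodeBL : ℕ → Partition → Set
NodeBL ℓ λ′ = ∃ λ is → All (λ i → i < ℓ) is × applyF̂ ℓ is (just []) ≡ just λ′

module Submission where

-- The proof only needs ℓ ≥ 2.
--
-- The key fact (core-addable-removable) is that in an ℓ-core an addable and a
-- removable box never share a residue: else the box in the row of the upper one and
-- the column of the lower one has hook length divisible by ℓ.  So along ANY reading
-- order the i-signature of a core is sorted "+⋯+ −⋯−" and all addable i-boxes are
-- conormal; adding the last one turns its + into − and changes no other entry, as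
-- neighbouring positions have different residues.  Hence f^φ adds exactly all
-- addable i-boxes, for every reading that lists each position once (Signatures.OnCore);
-- the classical and the ladder readings both do (Agreement).
-- For the second part, removing all removable i-boxes of a nonempty core, with i the
-- residue of the last box of the last row, gives a smaller core μ whose addable
-- i-boxes are the removed ones, so λ = f̂_i^φ̂ μ (Removal); induct on the size.

open import Defs
open import Data.Nat using (ℕ; _≤_; _<_)
open import Data.Maybe using (just)
open import Data.Product using (_×_)
open import Relation.Binary.PropositionalEquality using (_≡_)

open import Data.Nat
open import Data.Nat.Properties
open import Data.Nat.DivMod using (_%_; %-distribˡ-+; m%n%n≡m%n; [m+kn]%n≡m%n; m<n⇒m%n≡m; n%n≡0; m%n≤n)
open import Data.Nat.Divisibility using (_∣_; m%n≡0⇒n∣m; n∣m⇒m%n≡0)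
open import Data.Nat.Solver using (module +-*-Solver)
import Data.Integer as ℤ
import Data.Integer.Properties as ℤ
import Data.Integer.DivMod as ℤ
open import Data.Integer.Base using (_%ℕ_)
open import Data.Bool using (Bool; true; false; _∧_; _∨_; not; if_then_else_)
open import Data.Bool.Properties using (∧-conicalˡ; ∧-conicalʳ; T-≡)
open import Data.List using (List; []; _∷_; _++_; length; map; concatMap; reverse; upTo; applyUpTo; _∷ʳ_; replicate)
open import Data.List.Properties
  using (concatMap-++; concatMap-cong; concatMap-map; map-concatMap; map-upTo; applyUpTo-∷ʳ; unfold-reverse;
         reverse-++; reverse-involutive; length-reverse; length-map; length-upTo; map-++; map-∘; ++-identityʳ; ++-assoc)
open import Data.Nat.ListAction using (sum)
open import Data.Nat.ListAction.Properties using (sum-++)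
open import Data.List.Relation.Unary.All using (All; []; _∷_)
open import Data.List.Relation.Unary.All.Properties using (++⁺; ++⁻ʳ; replicate⁺)
open import Data.List.Relation.Unary.Linked using (_∷_)
open import Data.Maybe using (Maybe; _>>=_)
open import Data.Product using (Σ; _,_; proj₁; proj₂)
open import Data.Product.Properties using (,-injectiveˡ; ,-injectiveʳ)
open import Data.Sum using (_⊎_; inj₁; inj₂)
open import Data.Empty using (⊥; ⊥-elim)
open import Relation.Nullary using (¬_; Dec; yes; no)
open import Function.Bundles using (Equivalence)
open import Relation.Binary.Definitions using (tri<; tri≈; tri>)
open import Relation.Binary.PropositionalEquality
  using (_≢_; refl; sym; trans; cong; cong₂; subst; subst₂; module ≡-Reasoning)

private variable
  A B C : Set

∨-true : ∀ {x y} → x ∨ y ≡ true → x ≡ true ⊎ y ≡ true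
∨-true {true}  _ = inj₁ refl
∨-true {false} e = inj₂ e

not-true : ∀ {x} → not x ≡ true → x ≡ false
not-true {false} _ = refl

≤ᵇ⇒≤′ : ∀ {m n} → (m ≤ᵇ n) ≡ true → m ≤ n
≤ᵇ⇒≤′ {m} {n} e = ≤ᵇ⇒≤ m n (Equivalence.from T-≡ e)

≤⇒≤ᵇ′ : ∀ {m n} → m ≤ n → (m ≤ᵇ n) ≡ true
≤⇒≤ᵇ′ le = Equivalence.to T-≡ (≤⇒≤ᵇ le)

≰⇒≤ᵇ-false : ∀ {m n} → ¬ (m ≤ n) → (m ≤ᵇ n) ≡ false
≰⇒≤ᵇ-false {m} {n} m≰n with m ≤ᵇ n in eq
... | true  = ⊥-elim (m≰n (≤ᵇ⇒≤′ eq))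
... | false = refl

≤ᵇ-false⇒> : ∀ {m n} → (m ≤ᵇ n) ≡ false → n < m
≤ᵇ-false⇒> {m} {n} e with m ≤? n
... | yes m≤n = ⊥-elim (subst (λ z → z ≡ false → ⊥) (sym (≤⇒≤ᵇ′ m≤n)) (λ ()) e)
... | no  m≰n = ≰⇒> m≰n

≡ᵇ⇒≡′ : ∀ {a b} → (a ≡ᵇ b) ≡ true → a ≡ b
≡ᵇ⇒≡′ {a} {b} e = ≡ᵇ⇒≡ a b (Equivalence.from T-≡ e)

≡ᵇ-refl : ∀ a → (a ≡ᵇ a) ≡ true
≡ᵇ-refl a = Equivalence.to T-≡ (≡⇒≡ᵇ a a refl)

≢⇒≡ᵇ-false : ∀ {a b} → a ≢ b → (a ≡ᵇ b) ≡ false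
≢⇒≡ᵇ-false {a} {b} a≢b with a ≡ᵇ b in eq
... | true  = ⊥-elim (a≢b (≡ᵇ⇒≡′ eq))
... | false = refl

sumBy : (A → ℕ) → List A → ℕ
sumBy f xs = sum (map f xs)

sumBy-++ : (f : A → ℕ) (xs ys : List A) → sumBy f (xs ++ ys) ≡ sumBy f xs + sumBy f ys
sumBy-++ f xs ys = trans (cong sum (map-++ f xs ys)) (sum-++ (map f xs) (map f ys))

sumBy-cong : {f g : A → ℕ} → (∀ x → f x ≡ g x) → (xs : List A) → sumBy f xs ≡ sumBy g xs
sumBy-cong f≗g []       = refl
sumBy-cong f≗g (x ∷ xs) = cong₂ _+_ (f≗g x) (sumBy-cong f≗g xs)

sumBy-mono : {f g : A → ℕ} → (∀ x → f x ≤ g x) → (xs : List A) → sumBy f xs ≤ sumBy g xs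
sumBy-mono f≤g []       = z≤n
sumBy-mono f≤g (x ∷ xs) = +-mono-≤ (f≤g x) (sumBy-mono f≤g xs)

sumBy-*ʳ : (f : A → ℕ) (k : ℕ) (xs : List A) → sumBy (λ x → f x * k) xs ≡ sumBy f xs * k
sumBy-*ʳ f k []       = refl
sumBy-*ʳ f k (x ∷ xs) = trans (cong (f x * k +_) (sumBy-*ʳ f k xs)) (sym (*-distribʳ-+ k (f x) _))

sumBy-*ˡ : (f : A → ℕ) (k : ℕ) (xs : List A) → sumBy (λ x → k * f x) xs ≡ k * sumBy f xs
sumBy-*ˡ f k xs = trans (sumBy-cong (λ x → *-comm k (f x)) xs) (trans (sumBy-*ʳ f k xs) (*-comm _ k))

sumBy-+ : (f g : A → ℕ) (xs : List A) → sumBy (λ x → f x + g x) xs ≡ sumBy f xs + sumBy g xs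
sumBy-+ f g []       = refl
sumBy-+ f g (x ∷ xs) = trans (cong (f x + g x +_) (sumBy-+ f g xs)) (+-*-Solver.solve 4
  (λ a b c d → (a :+ b) :+ (c :+ d) := (a :+ c) :+ (b :+ d)) refl (f x) (g x) (sumBy f xs) (sumBy g xs))
  where open +-*-Solver

sumBy-const0 : (xs : List A) → sumBy (λ _ → 0) xs ≡ 0
sumBy-const0 []       = refl
sumBy-const0 (x ∷ xs) = sumBy-const0 xs

sumBy-map : (f : B → ℕ) (g : A → B) (xs : List A) → sumBy f (map g xs) ≡ sumBy (λ x → f (g x)) xs
sumBy-map f g []       = refl
sumBy-map f g (x ∷ xs) = cong (f (g x) +_) (sumBy-map f g xs)

sumBy-concatMap : (f : B → ℕ) (g : A → List B) (xs : List A) →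
                  sumBy f (concatMap g xs) ≡ sumBy (λ x → sumBy f (g x)) xs
sumBy-concatMap f g []       = refl
sumBy-concatMap f g (x ∷ xs) =
  trans (sumBy-++ f (g x) (concatMap g xs)) (cong (sumBy f (g x) +_) (sumBy-concatMap f g xs))

sumBy-reverse : (f : A → ℕ) (xs : List A) → sumBy f (reverse xs) ≡ sumBy f xs
sumBy-reverse f []       = refl
sumBy-reverse f (x ∷ xs) = begin
  sumBy f (reverse (x ∷ xs))       ≡⟨ cong (sumBy f) (unfold-reverse x xs) ⟩
  sumBy f (reverse xs ++ x ∷ [])   ≡⟨ sumBy-++ f (reverse xs) (x ∷ []) ⟩
  sumBy f (reverse xs) + (f x + 0) ≡⟨ cong₂ _+_ (sumBy-reverse f xs) (+-identityʳ (f x)) ⟩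
  sumBy f xs + f x                 ≡⟨ +-comm _ (f x) ⟩
  f x + sumBy f xs                 ∎
  where open ≡-Reasoning

sumBy-swap : (g : A → B → ℕ) (xs : List A) (ys : List B) →
             sumBy (λ x → sumBy (g x) ys) xs ≡ sumBy (λ y → sumBy (λ x → g x y) xs) ys
sumBy-swap g []       ys = sym (sumBy-const0 ys)
sumBy-swap g (x ∷ xs) ys =
  trans (cong (sumBy (g x) ys +_) (sumBy-swap g xs ys)) (sym (sumBy-+ (g x) _ ys))

concatMap-concatMap : (f : B → List C) (g : A → List B) (xs : List A) →
                      concatMap f (concatMap g xs) ≡ concatMap (λ x → concatMap f (g x)) xs
concatMap-concatMap f g []       = refl
concatMap-concatMap f g (x ∷ xs) =
  trans (concatMap-++ f (g x) (concatMap g xs)) (cong (concatMap f (g x) ++_) (concatMap-concatMap f g xs))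

concatMap-[] : (f : A → List B) → (∀ x → f x ≡ []) → (xs : List A) → concatMap f xs ≡ []
concatMap-[] f f≡[] []       = refl
concatMap-[] f f≡[] (x ∷ xs) rewrite f≡[] x = concatMap-[] f f≡[] xs

δ : ℕ → ℕ → ℕ
δ a b = if a ≡ᵇ b then 1 else 0

δ-refl : ∀ a → δ a a ≡ 1
δ-refl a rewrite ≡ᵇ-refl a = refl

δ-≢ : ∀ {a b} → a ≢ b → δ a b ≡ 0
δ-≢ a≢b rewrite ≢⇒≡ᵇ-false a≢b = refl

δ-sym : ∀ a b → δ a b ≡ δ b a
δ-sym a b with a ≟ b
... | yes refl = refl
... | no  a≢b  rewrite δ-≢ a≢b | δ-≢ (λ e → a≢b (sym e)) = refl

δ₂ : Pos → Pos → ℕ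
δ₂ (a , b) (c , d) = δ a c * δ b d

δ₂-refl : ∀ p → δ₂ p p ≡ 1
δ₂-refl (a , b) rewrite δ-refl a | δ-refl b = refl

δ₂≡0⇒≢ : ∀ {p q} → δ₂ p q ≡ 0 → p ≢ q
δ₂≡0⇒≢ {p} δ≡0 refl with () ← trans (sym (δ₂-refl p)) δ≡0

mult : Pos → List Pos → ℕ
mult q = sumBy (λ x → δ₂ x q)

multℕ : ℕ → List ℕ → ℕ
multℕ y = sumBy (λ x → δ x y)

oneTo-snoc : ∀ n → oneTo (suc n) ≡ oneTo n ++ suc n ∷ []
oneTo-snoc n = begin
  oneTo (suc n)                ≡⟨ map-upTo suc (suc n) ⟩
  applyUpTo suc (suc n)        ≡⟨ sym (applyUpTo-∷ʳ suc n) ⟩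
  applyUpTo suc n ∷ʳ suc n     ≡⟨ cong (_∷ʳ suc n) (sym (map-upTo suc n)) ⟩
  oneTo n ++ suc n ∷ []        ∎
  where open ≡-Reasoning

oneTo-cons : ∀ n → oneTo (suc n) ≡ 1 ∷ map suc (oneTo n)
oneTo-cons n = cong (λ z → 1 ∷ map suc z) (sym (map-upTo suc n))

length-oneTo : ∀ n → length (oneTo n) ≡ n
length-oneTo n = trans (length-map suc (upTo n)) (length-upTo n)

sumBy-oneTo-snoc : (f : ℕ → ℕ) (n : ℕ) → sumBy f (oneTo (suc n)) ≡ sumBy f (oneTo n) + (f (suc n) + 0)
sumBy-oneTo-snoc f n = trans (cong (sumBy f) (oneTo-snoc n)) (sumBy-++ f (oneTo n) (suc n ∷ []))

multℕ-oneTo-out : ∀ y n → y ≡ 0 ⊎ n < y → multℕ y (oneTo n) ≡ 0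
multℕ-oneTo-out y zero    _   = refl
multℕ-oneTo-out y (suc n) out = trans (sumBy-oneTo-snoc (λ x → δ x y) n)
  (cong₂ _+_ (multℕ-oneTo-out y n (smaller out)) (cong (_+ 0) (δ-≢ (differs out))))
  where
  smaller : y ≡ 0 ⊎ suc n < y → y ≡ 0 ⊎ n < y
  smaller (inj₁ y≡0) = inj₁ y≡0
  smaller (inj₂ n<y) = inj₂ (<-trans (n<1+n n) n<y)
  differs : y ≡ 0 ⊎ suc n < y → suc n ≢ y
  differs (inj₁ y≡0) e = 1+n≢0 (trans e y≡0)
  differs (inj₂ n<y) e = <-irrefl e n<y

multℕ-oneTo-in : ∀ y n → 1 ≤ y → y ≤ n → multℕ y (oneTo n) ≡ 1
multℕ-oneTo-in y zero    1≤y y≤n = ⊥-elim (<⇒≱ 1≤y y≤n)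
multℕ-oneTo-in y (suc n) 1≤y y≤n with y ≟ suc n
... | yes refl = trans (sumBy-oneTo-snoc (λ x → δ x y) n)
                   (cong₂ _+_ (multℕ-oneTo-out y n (inj₂ ≤-refl)) (cong (_+ 0) (δ-refl y)))
... | no  y≢   = trans (sumBy-oneTo-snoc (λ x → δ x y) n)
                   (cong₂ _+_ (multℕ-oneTo-in y n 1≤y (m<1+n⇒m≤n (≤∧≢⇒< y≤n y≢)))
                              (cong (_+ 0) (δ-≢ (λ e → y≢ (sym e)))))

multℕ-oneTo-≤1 : ∀ y n → multℕ y (oneTo n) ≤ 1
multℕ-oneTo-≤1 zero    n rewrite multℕ-oneTo-out zero n (inj₁ refl) = z≤n
multℕ-oneTo-≤1 (suc y) n with suc y ≤? n
... | yes le  rewrite multℕ-oneTo-in (suc y) n (s≤s z≤n) le = ≤-refl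
... | no  nle rewrite multℕ-oneTo-out (suc y) n (inj₂ (≰⇒> nle)) = z≤n

concatMap-oneTo-trim : (f : ℕ → List B) (n n' : ℕ) → n ≤ n' → (∀ x → n < x → f x ≡ []) →
                       concatMap f (oneTo n') ≡ concatMap f (oneTo n)
concatMap-oneTo-trim f n n' n≤n' vanish =
  subst (λ z → concatMap f (oneTo z) ≡ concatMap f (oneTo n)) (m+[n∸m]≡n n≤n') (extend (n' ∸ n))
  where
  extend : ∀ k → concatMap f (oneTo (n + k)) ≡ concatMap f (oneTo n)
  extend zero    rewrite +-identityʳ n = refl
  extend (suc k) = begin
    concatMap f (oneTo (n + suc k))                        ≡⟨ cong (λ z → concatMap f (oneTo z)) (+-suc n k) ⟩
    concatMap f (oneTo (suc (n + k)))                      ≡⟨ cong (concatMap f) (oneTo-snoc (n + k)) ⟩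
    concatMap f (oneTo (n + k) ++ suc (n + k) ∷ [])        ≡⟨ concatMap-++ f (oneTo (n + k)) _ ⟩
    concatMap f (oneTo (n + k)) ++ (f (suc (n + k)) ++ []) ≡⟨ cong (λ z → concatMap f (oneTo (n + k)) ++ (z ++ []))
                                                                    (vanish _ (s≤s (m≤m+n n k))) ⟩
    concatMap f (oneTo (n + k)) ++ []                      ≡⟨ ++-identityʳ _ ⟩
    concatMap f (oneTo (n + k))                            ≡⟨ extend k ⟩
    concatMap f (oneTo n)                                  ∎
    where open ≡-Reasoning

sumBy-oneTo-trim : (f : ℕ → ℕ) (n n' : ℕ) → n ≤ n' → (∀ x → n < x → f x ≡ 0) →
                   sumBy f (oneTo n') ≡ sumBy f (oneTo n)
sumBy-oneTo-trim f n n' n≤n' vanish =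
  subst (λ z → sumBy f (oneTo z) ≡ sumBy f (oneTo n)) (m+[n∸m]≡n n≤n') (extend (n' ∸ n))
  where
  extend : ∀ k → sumBy f (oneTo (n + k)) ≡ sumBy f (oneTo n)
  extend zero    rewrite +-identityʳ n = refl
  extend (suc k) = begin
    sumBy f (oneTo (n + suc k))                   ≡⟨ cong (λ z → sumBy f (oneTo z)) (+-suc n k) ⟩
    sumBy f (oneTo (suc (n + k)))                 ≡⟨ sumBy-oneTo-snoc f (n + k) ⟩
    sumBy f (oneTo (n + k)) + (f (suc (n + k)) + 0) ≡⟨ cong (λ z → sumBy f (oneTo (n + k)) + (z + 0)) (vanish _ (s≤s (m≤m+n n k))) ⟩
    sumBy f (oneTo (n + k)) + 0                   ≡⟨ +-identityʳ _ ⟩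
    sumBy f (oneTo (n + k))                       ≡⟨ extend k ⟩
    sumBy f (oneTo n)                             ∎
    where open ≡-Reasoning

concatMap-revOneTo-trim : (f : ℕ → List B) (n n' : ℕ) → n ≤ n' → (∀ x → n < x → f x ≡ []) →
                          concatMap f (reverse (oneTo n')) ≡ concatMap f (reverse (oneTo n))
concatMap-revOneTo-trim f n n' n≤n' vanish =
  subst (λ z → concatMap f (reverse (oneTo z)) ≡ concatMap f (reverse (oneTo n))) (m+[n∸m]≡n n≤n') (extend (n' ∸ n))
  where
  extend : ∀ k → concatMap f (reverse (oneTo (n + k))) ≡ concatMap f (reverse (oneTo n))
  extend zero    rewrite +-identityʳ n = refl
  extend (suc k) = begin
    concatMap f (reverse (oneTo (n + suc k)))                  ≡⟨ cong (λ z → concatMap f (reverse (oneTo z))) (+-suc n k) ⟩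
    concatMap f (reverse (oneTo (suc (n + k))))                ≡⟨ cong (λ z → concatMap f (reverse z)) (oneTo-snoc (n + k)) ⟩
    concatMap f (reverse (oneTo (n + k) ++ suc (n + k) ∷ []))  ≡⟨ cong (concatMap f) (reverse-++ (oneTo (n + k)) _) ⟩
    f (suc (n + k)) ++ concatMap f (reverse (oneTo (n + k)))   ≡⟨ cong (_++ concatMap f (reverse (oneTo (n + k)))) (vanish _ (s≤s (m≤m+n n k))) ⟩
    concatMap f (reverse (oneTo (n + k)))                      ≡⟨ extend k ⟩
    concatMap f (reverse (oneTo n))                            ∎
    where open ≡-Reasoning

data WF : Partition → Set where
  wf[] : WF []
  wf∷  : ∀ {x xs} → 0 < x → row xs 1 ≤ x → WF xs → WF (x ∷ xs)

IsPartition⇒WF : ∀ μ → IsPartition μ → WF μ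
IsPartition⇒WF []           _                  = wf[]
IsPartition⇒WF (x ∷ [])     (_ , x>0 ∷ _)      = wf∷ x>0 z≤n wf[]
IsPartition⇒WF (x ∷ y ∷ xs) (y≤x ∷ ls , x>0 ∷ ps) = wf∷ x>0 y≤x (IsPartition⇒WF (y ∷ xs) (ls , ps))

row-zero : ∀ μ → row μ 0 ≡ 0
row-zero []      = refl
row-zero (_ ∷ _) = refl

row-beyond : ∀ μ a → length μ < a → row μ a ≡ 0
row-beyond []       a             _         = refl
row-beyond (x ∷ μ) (suc (suc a)) (s≤s lt) = row-beyond μ (suc a) lt

row-antitone : ∀ {μ} → WF μ → ∀ a b → 1 ≤ a → a ≤ b → row μ b ≤ row μ a
row-antitone w a zero    1≤a a≤b = ⊥-elim (<⇒≱ 1≤a a≤b)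
row-antitone w a (suc b) 1≤a a≤b with m≤n⇒m<n∨m≡n a≤b
... | inj₂ refl = ≤-refl
... | inj₁ (s≤s a≤b') with b
...   | zero    = ⊥-elim (<⇒≱ 1≤a a≤b')
...   | suc b'' = ≤-trans (step w b'') (row-antitone w a (suc b'') 1≤a a≤b')
  where
  step : ∀ {μ} → WF μ → ∀ k → row μ (suc (suc k)) ≤ row μ (suc k)
  step wf[]                       k       = z≤n
  step (wf∷ {xs = []} _ _ _)      zero    = z≤n
  step (wf∷ {xs = _ ∷ _} _ y≤x _) zero    = y≤x
  step (wf∷ _ _ w)                (suc k) = step w k

row≤row₁ : ∀ {μ} → WF μ → ∀ a → row μ a ≤ row μ 1
row≤row₁ {μ} w zero    rewrite row-zero μ = z≤n
row≤row₁     w (suc a) = row-antitone w 1 (suc a) ≤-refl (s≤s z≤n)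

row-positive : ∀ {μ} → WF μ → ∀ a → 1 ≤ a → a ≤ length μ → 1 ≤ row μ a
row-positive (wf∷ x>0 _ _) (suc zero)    _ _        = x>0
row-positive (wf∷ _ _ w)   (suc (suc a)) _ (s≤s le) = row-positive w (suc a) (s≤s z≤n) le

WF-row-ext : ∀ {μ ν} → WF μ → WF ν → (∀ a → row μ a ≡ row ν a) → μ ≡ ν
WF-row-ext wf[]          wf[]          _ = refl
WF-row-ext wf[]          (wf∷ y>0 _ _) e = ⊥-elim (<⇒≢ y>0 (e 1))
WF-row-ext (wf∷ x>0 _ _) wf[]          e = ⊥-elim (<⇒≢ x>0 (sym (e 1)))
WF-row-ext {x ∷ xs} {y ∷ ys} (wf∷ _ _ w) (wf∷ _ _ w') e = cong₂ _∷_ (e 1) (WF-row-ext w w' tail)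
  where
  tail : ∀ a → row xs a ≡ row ys a
  tail zero    = trans (row-zero xs) (sym (row-zero ys))
  tail (suc a) = e (suc (suc a))

inDiag⇒ : ∀ μ a b → inDiag μ a b ≡ true → 1 ≤ a × 1 ≤ b × b ≤ row μ a
inDiag⇒ μ a b e =
  ≤ᵇ⇒≤′ (∧-conicalˡ _ _ e) , ≤ᵇ⇒≤′ (∧-conicalˡ _ _ e₁) , ≤ᵇ⇒≤′ (∧-conicalʳ (1 ≤ᵇ b) _ e₁)
  where e₁ = ∧-conicalʳ (1 ≤ᵇ a) _ e

⇒inDiag : ∀ μ a b → 1 ≤ a → 1 ≤ b → b ≤ row μ a → inDiag μ a b ≡ true
⇒inDiag μ a b 1≤a 1≤b b≤r rewrite ≤⇒≤ᵇ′ 1≤a | ≤⇒≤ᵇ′ 1≤b | ≤⇒≤ᵇ′ b≤r = refl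

⇒notInDiag : ∀ μ a b → row μ a < b → inDiag μ a b ≡ false
⇒notInDiag μ a b r<b rewrite ≰⇒≤ᵇ-false (<⇒≱ r<b) with 1 ≤ᵇ a | 1 ≤ᵇ b
... | true  | true  = refl
... | true  | false = refl
... | false | _     = refl

notInDiag⇒ : ∀ μ a b → inDiag μ a b ≡ false → 1 ≤ a → 1 ≤ b → row μ a < b
notInDiag⇒ μ a b e 1≤a 1≤b with b ≤? row μ a
... | yes b≤r = ⊥-elim (subst (λ z → z ≡ false → ⊥) (sym (⇒inDiag μ a b 1≤a 1≤b b≤r)) (λ ()) e)
... | no  b≰r = ≰⇒> b≰r

CanGrow : Partition → ℕ → Set
CanGrow μ a = a ≡ 1 ⊎ suc (row μ a) ≤ row μ (a ∸ 1)

addable⇒ : ∀ μ a b → addable μ a b ≡ true → 1 ≤ a × b ≡ suc (row μ a) × CanGrow μ a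
addable⇒ μ a b e = 1≤a , b≡ , grow
  where
  e₁ = ∧-conicalʳ (1 ≤ᵇ a) _ e
  e₂ = ∧-conicalʳ (1 ≤ᵇ b) _ e₁
  e₃ = ∧-conicalʳ (not (inDiag μ a b)) _ e₂
  1≤a : 1 ≤ a
  1≤a = ≤ᵇ⇒≤′ (∧-conicalˡ _ _ e)
  1≤b : 1 ≤ b
  1≤b = ≤ᵇ⇒≤′ (∧-conicalˡ _ _ e₁)
  r<b : row μ a < b
  r<b = notInDiag⇒ μ a b (not-true (∧-conicalˡ _ _ e₂)) 1≤a 1≤b
  b≡ : b ≡ suc (row μ a)
  b≡ with ∨-true (∧-conicalʳ ((a ≡ᵇ 1) ∨ inDiag μ (a ∸ 1) b) _ e₃)
  ... | inj₁ b≡1  = trans (≡ᵇ⇒≡′ b≡1) (cong suc (sym (n<1⇒n≡0 (subst (row μ a <_) (≡ᵇ⇒≡′ b≡1) r<b))))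
  ... | inj₂ left = ≤-antisym (subst (_≤ suc (row μ a)) (m+[n∸m]≡n 1≤b) (s≤s (proj₂ (proj₂ (inDiag⇒ μ a (b ∸ 1) left))))) r<b
  grow : CanGrow μ a
  grow with ∨-true (∧-conicalˡ _ _ e₃)
  ... | inj₁ a≡1 = inj₁ (≡ᵇ⇒≡′ a≡1)
  ... | inj₂ up  = inj₂ (subst (_≤ row μ (a ∸ 1)) b≡ (proj₂ (proj₂ (inDiag⇒ μ (a ∸ 1) b up))))

⇒addable : ∀ μ a → 1 ≤ a → CanGrow μ a → addable μ a (suc (row μ a)) ≡ true
⇒addable μ a 1≤a grow =
  conj (≤⇒≤ᵇ′ 1≤a) refl (⇒notInDiag μ a (suc (row μ a)) ≤-refl) (upper grow) (left (row μ a) refl)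
  where
  conj : ∀ {p q r x y} → p ≡ true → q ≡ true → r ≡ false → x ≡ true → y ≡ true → (p ∧ q ∧ not r ∧ x ∧ y) ≡ true
  conj refl refl refl refl refl = refl
  upper : CanGrow μ a → ((a ≡ᵇ 1) ∨ inDiag μ (a ∸ 1) (suc (row μ a))) ≡ true
  upper (inj₁ refl) = refl
  upper (inj₂ le) with a ≟ 1
  ... | yes refl = refl
  ... | no  a≢1  rewrite ≢⇒≡ᵇ-false a≢1 =
    ⇒inDiag μ (a ∸ 1) _ (∸-monoˡ-≤ 1 (≤∧≢⇒< 1≤a (λ e → a≢1 (sym e)))) (s≤s z≤n) le
  left : ∀ r → row μ a ≡ r → ((suc r ≡ᵇ 1) ∨ inDiag μ a r) ≡ true
  left zero    _ = refl
  left (suc r) e rewrite ⇒inDiag μ a (suc r) 1≤a (s≤s z≤n) (≤-reflexive (sym e)) = refl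

removable⇒ : ∀ μ a b → removable μ a b ≡ true → 1 ≤ a × 1 ≤ b × b ≡ row μ a × row μ (suc a) < b
removable⇒ μ a b e with inDiag⇒ μ a b (∧-conicalˡ _ _ e)
... | 1≤a , 1≤b , b≤r = 1≤a , 1≤b , b≡ , below
  where
  e₁ = ∧-conicalʳ (inDiag μ a b) _ e
  b≡ : b ≡ row μ a
  b≡ = ≤-antisym b≤r (m<1+n⇒m≤n (notInDiag⇒ μ a (suc b) (not-true (∧-conicalʳ (not (inDiag μ (suc a) b)) _ e₁)) 1≤a (s≤s z≤n)))
  below : row μ (suc a) < b
  below = notInDiag⇒ μ (suc a) b (not-true (∧-conicalˡ _ _ e₁)) (s≤s z≤n) 1≤b

⇒removable : ∀ μ a → 1 ≤ a → 1 ≤ row μ a → row μ (suc a) < row μ a → removable μ a (row μ a) ≡ true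
⇒removable μ a 1≤a 1≤r below =
  conj (⇒inDiag μ a (row μ a) 1≤a 1≤r ≤-refl) (⇒notInDiag μ (suc a) (row μ a) below) (⇒notInDiag μ a (suc (row μ a)) ≤-refl)
  where
  conj : ∀ {p q r} → p ≡ true → q ≡ false → r ≡ false → (p ∧ not q ∧ not r) ≡ true
  conj refl refl refl = refl

addRow-row : ∀ μ a → 1 ≤ a → a ≤ suc (length μ) → ∀ x → row (addRow a μ) x ≡ row μ x + δ a x
addRow-row []       (suc zero)    _ _        zero          = refl
addRow-row []       (suc zero)    _ _        (suc zero)    = refl
addRow-row []       (suc zero)    _ _        (suc (suc x)) = refl
addRow-row []       (suc (suc a)) _ (s≤s ()) x
addRow-row (y ∷ ys) (suc zero)    _ _        zero          = refl
addRow-row (y ∷ ys) (suc zero)    _ _        (suc zero)    = sym (+-comm y 1)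
addRow-row (y ∷ ys) (suc zero)    _ _        (suc (suc x)) = sym (+-identityʳ _)
addRow-row (y ∷ ys) (suc (suc a)) _ _        zero          = refl
addRow-row (y ∷ ys) (suc (suc a)) _ _        (suc zero)    = sym (+-identityʳ y)
addRow-row (y ∷ ys) (suc (suc a)) _ (s≤s le) (suc (suc x)) = addRow-row ys (suc a) (s≤s z≤n) le (suc x)

addRow-length : ∀ μ a → length (addRow a μ) ≤ suc (length μ)
addRow-length []       a             = ≤-refl
addRow-length (y ∷ ys) zero          = n≤1+n _
addRow-length (y ∷ ys) (suc zero)    = n≤1+n _
addRow-length (y ∷ ys) (suc (suc a)) = s≤s (addRow-length ys (suc a))

addRow-row₁ : ∀ μ a → row (addRow a μ) 1 ≤ suc (row μ 1)
addRow-row₁ []       a             = ≤-refl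
addRow-row₁ (y ∷ ys) zero          = n≤1+n y
addRow-row₁ (y ∷ ys) (suc zero)    = ≤-refl
addRow-row₁ (y ∷ ys) (suc (suc a)) = n≤1+n y

addRow-WF : ∀ {μ} → WF μ → ∀ a → 1 ≤ a → a ≤ suc (length μ) → CanGrow μ a → WF (addRow a μ)
addRow-WF wf[]        (suc zero) _ _ _ = wf∷ (s≤s z≤n) z≤n wf[]
addRow-WF wf[]        (suc (suc a)) _ (s≤s ()) _
addRow-WF (wf∷ p h w) (suc zero) _ _ _ = wf∷ (s≤s z≤n) (≤-trans h (n≤1+n _)) w
addRow-WF {y ∷ ys} (wf∷ p h w) (suc (suc zero)) _ (s≤s le) (inj₂ grow) =
  wf∷ p (subst (_≤ y) (trans (+-comm 1 (row ys 1)) (sym (addRow-row ys 1 ≤-refl le 1))) grow)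
        (addRow-WF w 1 ≤-refl le (inj₁ refl))
addRow-WF {y ∷ ys} (wf∷ p h w) (suc (suc (suc a))) _ (s≤s le) (inj₂ grow) =
  wf∷ p (subst (_≤ y) (trans (sym (+-identityʳ (row ys 1))) (sym (addRow-row ys (suc (suc a)) (s≤s z≤n) le 1))) h)
        (addRow-WF w (suc (suc a)) (s≤s z≤n) le (inj₂ grow))

inDiag-addRow : ∀ μ a → 1 ≤ a → a ≤ suc (length μ) → ∀ x y → (x , y) ≢ (a , suc (row μ a)) →
                inDiag (addRow a μ) x y ≡ inDiag μ x y
inDiag-addRow μ a 1≤a a≤ x y other = cong (λ z → (1 ≤ᵇ x) ∧ (1 ≤ᵇ y) ∧ z) same
  where
  ≤ᵇ-suc : ∀ r → y ≢ suc r → (y ≤ᵇ suc r) ≡ (y ≤ᵇ r)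
  ≤ᵇ-suc r y≢ with y ≤? r
  ... | yes y≤r rewrite ≤⇒≤ᵇ′ y≤r | ≤⇒≤ᵇ′ (m≤n⇒m≤1+n y≤r) = refl
  ... | no  y≰r rewrite ≰⇒≤ᵇ-false y≰r | ≰⇒≤ᵇ-false {y} {suc r} (λ y≤ → y≢ (≤-antisym y≤ (≰⇒> y≰r))) = refl
  same : (y ≤ᵇ row (addRow a μ) x) ≡ (y ≤ᵇ row μ x)
  same rewrite addRow-row μ a 1≤a a≤ x with a ≟ x
  ... | yes refl rewrite δ-refl a | +-comm (row μ a) 1 = ≤ᵇ-suc (row μ a) (λ e → other (cong₂ _,_ refl e))
  ... | no  a≢x  rewrite δ-≢ a≢x | +-identityʳ (row μ x) = refl

addable-row≤ : ∀ {μ} → WF μ → ∀ a b → addable μ a b ≡ true → a ≤ suc (length μ)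
addable-row≤ {μ} w a b add with addable⇒ μ a b add
... | _   , _ , inj₁ refl = s≤s z≤n
... | 1≤a , _ , inj₂ up with a ∸ 1 ≤? length μ
...   | yes le  = subst (_≤ suc (length μ)) (m+[n∸m]≡n 1≤a) (s≤s le)
...   | no  nle = ⊥-elim (<⇒≱ (s≤s z≤n) (subst (suc (row μ a) ≤_) (row-beyond μ (a ∸ 1) (≰⇒> nle)) up))

addable-cong : ∀ μ ν a b → inDiag ν a b ≡ inDiag μ a b → inDiag ν (a ∸ 1) b ≡ inDiag μ (a ∸ 1) b →
               inDiag ν a (b ∸ 1) ≡ inDiag μ a (b ∸ 1) → addable ν a b ≡ addable μ a b
addable-cong μ ν a b e₁ e₂ e₃ =
  cong₂ (λ x y → (1 ≤ᵇ a) ∧ (1 ≤ᵇ b) ∧ not x ∧ y) e₁ (cong₂ (λ y z → ((a ≡ᵇ 1) ∨ y) ∧ ((b ≡ᵇ 1) ∨ z)) e₂ e₃)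

removable-cong : ∀ μ ν a b → inDiag ν a b ≡ inDiag μ a b → inDiag ν (suc a) b ≡ inDiag μ (suc a) b →
                 inDiag ν a (suc b) ≡ inDiag μ a (suc b) → removable ν a b ≡ removable μ a b
removable-cong μ ν a b e₁ e₂ e₃ = cong₂ _∧_ e₁ (cong₂ (λ y z → not y ∧ not z) e₂ e₃)

col-unique : ∀ {μ} → WF μ → ∀ k b → 1 ≤ b → (k ≡ 0 ⊎ b ≤ row μ k) → row μ (suc k) < b → col μ b ≡ k
col-unique wf[] zero    b _   _          _ = refl
col-unique wf[] (suc k) b _   (inj₁ ())  _
col-unique wf[] (suc k) b 1≤b (inj₂ b≤0) _ = ⊥-elim (<⇒≱ 1≤b b≤0)
col-unique {x ∷ xs} (wf∷ p h w) zero b 1≤b _ below with b ≤ᵇ x in eq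
... | true  = ⊥-elim (<⇒≱ below (≤ᵇ⇒≤′ eq))
... | false = col-unique w zero b 1≤b (inj₁ refl) (≤-<-trans h below)
col-unique {x ∷ xs} (wf∷ p h w) (suc k) b 1≤b reach below with b ≤ᵇ x in eq
... | true  = cong suc (col-unique w k b 1≤b (shift k reach) below)
  where
  shift : ∀ k → (suc k ≡ 0 ⊎ b ≤ row (x ∷ xs) (suc k)) → k ≡ 0 ⊎ b ≤ row xs k
  shift zero     _           = inj₁ refl
  shift (suc k') (inj₂ b≤)   = inj₂ b≤
... | false = ⊥-elim (<⇒≱ (≤ᵇ-false⇒> eq) (≤-trans (reached reach) (row≤row₁ (wf∷ p h w) (suc k))))
  where
  reached : (suc k ≡ 0 ⊎ b ≤ row (x ∷ xs) (suc k)) → b ≤ row (x ∷ xs) (suc k)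
  reached (inj₂ b≤) = b≤

col-spec : ∀ {μ} → WF μ → ∀ b → 1 ≤ b → (col μ b ≡ 0 ⊎ b ≤ row μ (col μ b)) × row μ (suc (col μ b)) < b
col-spec wf[] b 1≤b = inj₁ refl , 1≤b
col-spec {x ∷ xs} (wf∷ p h w) b 1≤b with b ≤ᵇ x in eq
... | false rewrite col-unique w zero b 1≤b (inj₁ refl) (≤-<-trans h (≤ᵇ-false⇒> eq)) = inj₁ refl , ≤ᵇ-false⇒> eq
... | true with col-spec w b 1≤b
... | reach , below = shift reach , below
  where
  shift : (col xs b ≡ 0 ⊎ b ≤ row xs (col xs b)) → suc (col xs b) ≡ 0 ⊎ b ≤ row (x ∷ xs) (suc (col xs b))
  shift (inj₁ e) rewrite e = inj₂ (≤ᵇ⇒≤′ eq)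
  shift (inj₂ le) with col xs b
  ... | zero  = inj₂ (≤ᵇ⇒≤′ eq)
  ... | suc k = inj₂ le

dropZeros : List ℕ → List ℕ
dropZeros []           = []
dropZeros (zero ∷ xs)  = dropZeros xs
dropZeros (suc x ∷ xs) = suc x ∷ dropZeros xs

fromRows : (ℕ → ℕ) → ℕ → Partition
fromRows r n = dropZeros (map r (oneTo n))

module FromRows (r : ℕ → ℕ) (n : ℕ) (r₀ : r 0 ≡ 0) (beyond : ∀ x → n < x → r x ≡ 0)
                (antitone : ∀ x → 1 ≤ x → r (suc x) ≤ r x) where

  data Decreasing : List ℕ → Set where
    dec[] : Decreasing []
    dec∷  : ∀ {x xs} → row xs 1 ≤ x → Decreasing xs → Decreasing (x ∷ xs)

  private
    row-map-oneTo : ∀ k (f : ℕ → ℕ) x → 1 ≤ x → x ≤ k → row (map f (oneTo k)) x ≡ f x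
    row-map-oneTo zero    f x             1≤x x≤0     = ⊥-elim (<⇒≱ 1≤x x≤0)
    row-map-oneTo (suc k) f (suc zero)    _   _       = cong (λ L → row (map f L) 1) (oneTo-cons k)
    row-map-oneTo (suc k) f (suc (suc x)) _   (s≤s le) = begin
      row (map f (oneTo (suc k))) (suc (suc x))   ≡⟨ cong (λ L → row (map f L) (suc (suc x))) (oneTo-cons k) ⟩
      row (map f (map suc (oneTo k))) (suc x)     ≡⟨ cong (λ L → row L (suc x)) (sym (map-∘ (oneTo k))) ⟩
      row (map (λ z → f (suc z)) (oneTo k)) (suc x) ≡⟨ row-map-oneTo k (λ z → f (suc z)) (suc x) (s≤s z≤n) le ⟩
      f (suc (suc x))                             ∎
      where open ≡-Reasoning

    Decreasing-row≤ : ∀ {L} → Decreasing L → ∀ x → row L x ≤ row L 1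
    Decreasing-row≤ dec[]        x             = z≤n
    Decreasing-row≤ (dec∷ h d)   zero          = z≤n
    Decreasing-row≤ (dec∷ h d)   (suc zero)    = ≤-refl
    Decreasing-row≤ (dec∷ h d)   (suc (suc x)) = ≤-trans (Decreasing-row≤ d (suc x)) h

    dropZeros-row : ∀ {L} → Decreasing L → ∀ x → row (dropZeros L) x ≡ row L x
    dropZeros-row dec[] x = refl
    dropZeros-row {suc y ∷ ys} (dec∷ h d) zero          = refl
    dropZeros-row {suc y ∷ ys} (dec∷ h d) (suc zero)    = refl
    dropZeros-row {suc y ∷ ys} (dec∷ h d) (suc (suc x)) = dropZeros-row d (suc x)
    dropZeros-row {zero ∷ ys}  (dec∷ h d) x =
      trans (dropZeros-row d x) (trans (n≤0⇒n≡0 (≤-trans (Decreasing-row≤ d x) h)) (sym (zeroRow x)))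
      where
      zeroRow : ∀ x → row (zero ∷ ys) x ≡ 0
      zeroRow zero          = refl
      zeroRow (suc zero)    = refl
      zeroRow (suc (suc x)) = n≤0⇒n≡0 (≤-trans (Decreasing-row≤ d (suc x)) h)

    dropZeros-WF : ∀ {L} → Decreasing L → WF (dropZeros L)
    dropZeros-WF dec[]                    = wf[]
    dropZeros-WF {zero ∷ ys}  (dec∷ h d)  = dropZeros-WF d
    dropZeros-WF {suc y ∷ ys} (dec∷ h d)  = wf∷ (s≤s z≤n) (subst (_≤ suc y) (sym (dropZeros-row d 1)) h) (dropZeros-WF d)

    dropZeros-length : ∀ L → length (dropZeros L) ≤ length L
    dropZeros-length []           = z≤n
    dropZeros-length (zero ∷ L)   = m≤n⇒m≤1+n (dropZeros-length L)
    dropZeros-length (suc x ∷ L)  = s≤s (dropZeros-length L)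

    rows : List ℕ
    rows = map r (oneTo n)

    row-rows : ∀ x → row rows x ≡ r x
    row-rows zero = trans (row-zero rows) (sym r₀)
    row-rows (suc x) with suc x ≤? n
    ... | yes x≤n = row-map-oneTo n r (suc x) (s≤s z≤n) x≤n
    ... | no  x≰n = trans (row-beyond rows (suc x) (subst (_< suc x) (sym (trans (length-map r (oneTo n)) (length-oneTo n))) (≰⇒> x≰n)))
                          (sym (beyond (suc x) (≰⇒> x≰n)))

    decreasing : ∀ L → (∀ x → 1 ≤ x → row L (suc x) ≤ row L x) → Decreasing L
    decreasing []       _ = dec[]
    decreasing (y ∷ ys) h = dec∷ (h 1 ≤-refl) (decreasing ys (λ { (suc x) _ → h (suc (suc x)) (s≤s z≤n) }))

    rows-decreasing : Decreasing rows
    rows-decreasing = decreasing rows (λ x 1≤x → subst₂ _≤_ (sym (row-rows (suc x))) (sym (row-rows x)) (antitone x 1≤x))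

  fromRows-row : ∀ x → row (fromRows r n) x ≡ r x
  fromRows-row x = trans (dropZeros-row rows-decreasing x) (row-rows x)

  fromRows-WF : WF (fromRows r n)
  fromRows-WF = dropZeros-WF rows-decreasing

  fromRows-length : length (fromRows r n) ≤ n
  fromRows-length = ≤-trans (dropZeros-length rows) (≤-reflexive (trans (length-map r (oneTo n)) (length-oneTo n)))

size : Partition → ℕ
size μ = sumBy (row μ) (oneTo (length μ))

size-over : ∀ μ N → length μ ≤ N → sumBy (row μ) (oneTo N) ≡ size μ
size-over μ N len≤N = sumBy-oneTo-trim (row μ) (length μ) N len≤N (row-beyond μ)

module Residues (m : ℕ) where

  ℓ : ℕ
  ℓ = suc m

  infix 4 _≈_
  _≈_ : ℕ → ℕ → Set
  x ≈ y = x % ℓ ≡ y % ℓ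

  %-absorbˡ : ∀ x y → ((x % ℓ) + y) % ℓ ≡ (x + y) % ℓ
  %-absorbˡ x y = begin
    ((x % ℓ) + y) % ℓ              ≡⟨ %-distribˡ-+ (x % ℓ) y ℓ ⟩
    ((x % ℓ % ℓ) + y % ℓ) % ℓ      ≡⟨ cong (λ z → (z + y % ℓ) % ℓ) (m%n%n≡m%n x ℓ) ⟩
    ((x % ℓ) + y % ℓ) % ℓ          ≡⟨ sym (%-distribˡ-+ x y ℓ) ⟩
    (x + y) % ℓ                    ∎
    where open ≡-Reasoning

  ≈-+ʳ : ∀ x y k → x ≈ y → x + k ≈ y + k
  ≈-+ʳ x y k x≈y = trans (sym (%-absorbˡ x k)) (trans (cong (λ z → (z + k) % ℓ) x≈y) (%-absorbˡ y k))

  ≈-cancelʳ : ∀ x y k → x + k ≈ y + k → x ≈ y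
  ≈-cancelʳ x y k e = begin
    x % ℓ                  ≡⟨ sym ([m+kn]%n≡m%n x k ℓ) ⟩
    (x + k * ℓ) % ℓ        ≡⟨ cong (_% ℓ) (regroup x) ⟩
    ((x + k) + k * m) % ℓ  ≡⟨ ≈-+ʳ (x + k) (y + k) (k * m) e ⟩
    ((y + k) + k * m) % ℓ  ≡⟨ cong (_% ℓ) (sym (regroup y)) ⟩
    (y + k * ℓ) % ℓ        ≡⟨ [m+kn]%n≡m%n y k ℓ ⟩
    y % ℓ                  ∎
    where
    open ≡-Reasoning
    regroup : ∀ z → z + k * ℓ ≡ (z + k) + k * m
    regroup z = trans (cong (z +_) (*-suc k m)) (sym (+-assoc z k (k * m)))

  ≈⇒∣∸ : ∀ x y → y ≤ x → x ≈ y → ℓ ∣ x ∸ y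
  ≈⇒∣∸ x y y≤x x≈y = m%n≡0⇒n∣m (x ∸ y) ℓ (≈-cancelʳ (x ∸ y) 0 y (trans (cong (_% ℓ) (m∸n+n≡m y≤x)) x≈y))

  ∣∸⇒≈ : ∀ x y → y ≤ x → ℓ ∣ x ∸ y → x ≈ y
  ∣∸⇒≈ x y y≤x ℓ∣ = begin
    x % ℓ                   ≡⟨ cong (_% ℓ) (sym (m∸n+n≡m y≤x)) ⟩
    (x ∸ y + y) % ℓ         ≡⟨ sym (%-absorbˡ (x ∸ y) y) ⟩
    ((x ∸ y) % ℓ + y) % ℓ   ≡⟨ cong (λ z → (z + y) % ℓ) (n∣m⇒m%n≡0 (x ∸ y) ℓ ℓ∣) ⟩
    y % ℓ                   ∎
    where open ≡-Reasoning

  res<ℓ : ∀ a b → res ℓ a b < ℓ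
  res<ℓ a b = ℤ.n%ℕd<d (ℤ.+ b ℤ.- ℤ.+ a) ℓ

  %-absorbʳ : ∀ x y → (x + y % ℓ) % ℓ ≡ (x + y) % ℓ
  %-absorbʳ x y = trans (cong (_% ℓ) (+-comm x _)) (trans (%-absorbˡ y x) (cong (_% ℓ) (+-comm y x)))

  res-negative : ∀ t → ℤ.-[1+ t ] %ℕ ℓ + suc t ≈ 0
  res-negative t with suc t % ℓ in eq
  ... | zero  = eq
  ... | suc r = begin
    (ℓ ∸ suc r + suc t) % ℓ        ≡⟨ sym (%-absorbʳ (ℓ ∸ suc r) (suc t)) ⟩
    (ℓ ∸ suc r + suc t % ℓ) % ℓ    ≡⟨ cong (λ z → (ℓ ∸ suc r + z) % ℓ) eq ⟩
    (ℓ ∸ suc r + suc r) % ℓ        ≡⟨ cong (_% ℓ) (m∸n+n≡m (subst (_≤ ℓ) eq (m%n≤n (suc t) ℓ))) ⟩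
    ℓ % ℓ                          ≡⟨ n%n≡0 ℓ ⟩
    0                              ∎
    where open ≡-Reasoning

  res-spec : ∀ a b → res ℓ a b + a ≈ b
  res-spec a b with a ≤? b
  ... | yes a≤b rewrite ℤ.m-n≡m⊖n b a | ℤ.⊖-≥ a≤b =
    trans (%-absorbˡ (b ∸ a) a) (cong (_% ℓ) (m∸n+n≡m a≤b))
  ... | no  a≰b = subst (λ a → res ℓ a b + a ≈ b) a≡ (above (a ∸ suc b))
    where
    a≡ : b + suc (a ∸ suc b) ≡ a
    a≡ = trans (+-suc b _) (m+[n∸m]≡n (≰⇒> a≰b))
    difference : ∀ t → ℤ.+ b ℤ.- ℤ.+ (b + suc t) ≡ ℤ.-[1+ t ]
    difference t = trans (ℤ.m-n≡m⊖n b (b + suc t))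
      (trans (ℤ.⊖-< (m<m+n b (s≤s z≤n))) (cong (λ z → ℤ.- (ℤ.+ z)) (m+n∸m≡n b (suc t))))
    above : ∀ t → res ℓ (b + suc t) b + (b + suc t) ≈ b
    above t rewrite difference t = begin
      (r + (b + suc t)) % ℓ          ≡⟨ cong (_% ℓ) (+-*-Solver.solve 3 (λ r b t → r :+ (b :+ t) := (r :+ t) :+ b) refl r b (suc t)) ⟩
      ((r + suc t) + b) % ℓ          ≡⟨ sym (%-absorbˡ (r + suc t) b) ⟩
      ((r + suc t) % ℓ + b) % ℓ      ≡⟨ cong (λ z → (z + b) % ℓ) (res-negative t) ⟩
      b % ℓ                          ∎
      where
      open ≡-Reasoning
      open +-*-Solver using (_:+_; _:=_)
      r = ℤ.-[1+ t ] %ℕ ℓ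

  res⇒≈ : ∀ a b c d → res ℓ a b ≡ res ℓ c d → b + c ≈ d + a
  res⇒≈ a b c d e = begin
    (b + c) % ℓ                ≡⟨ sym (%-absorbˡ b c) ⟩
    (b % ℓ + c) % ℓ            ≡⟨ cong (λ z → (z + c) % ℓ) (sym (res-spec a b)) ⟩
    ((r₁ + a) % ℓ + c) % ℓ     ≡⟨ %-absorbˡ (r₁ + a) c ⟩
    (r₁ + a + c) % ℓ           ≡⟨ cong (λ z → (z + a + c) % ℓ) e ⟩
    (r₂ + a + c) % ℓ           ≡⟨ cong (_% ℓ) (+-*-Solver.solve 3 (λ r a c → r :+ a :+ c := r :+ c :+ a) refl r₂ a c) ⟩
    (r₂ + c + a) % ℓ           ≡⟨ sym (%-absorbˡ (r₂ + c) a) ⟩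
    ((r₂ + c) % ℓ + a) % ℓ     ≡⟨ cong (λ z → (z + a) % ℓ) (res-spec c d) ⟩
    (d % ℓ + a) % ℓ            ≡⟨ %-absorbˡ d a ⟩
    (d + a) % ℓ                ∎
    where
    open ≡-Reasoning
    open +-*-Solver using (_:+_; _:=_)
    r₁ = res ℓ a b
    r₂ = res ℓ c d

  ≈⇒res : ∀ a b c d → b + c ≈ d + a → res ℓ a b ≡ res ℓ c d
  ≈⇒res a b c d e = begin
    r₁            ≡⟨ sym (m<n⇒m%n≡m (res<ℓ a b)) ⟩
    r₁ % ℓ        ≡⟨ ≈-cancelʳ r₁ r₂ (a + c) shifted ⟩
    r₂ % ℓ        ≡⟨ m<n⇒m%n≡m (res<ℓ c d) ⟩
    r₂            ∎
    where
    open ≡-Reasoning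
    open +-*-Solver using (_:+_; _:=_)
    r₁ = res ℓ a b
    r₂ = res ℓ c d
    shifted : r₁ + (a + c) ≈ r₂ + (a + c)
    shifted = begin
      (r₁ + (a + c)) % ℓ       ≡⟨ cong (_% ℓ) (sym (+-assoc r₁ a c)) ⟩
      (r₁ + a + c) % ℓ         ≡⟨ sym (%-absorbˡ (r₁ + a) c) ⟩
      ((r₁ + a) % ℓ + c) % ℓ   ≡⟨ cong (λ z → (z + c) % ℓ) (res-spec a b) ⟩
      (b % ℓ + c) % ℓ          ≡⟨ %-absorbˡ b c ⟩
      (b + c) % ℓ              ≡⟨ e ⟩
      (d + a) % ℓ              ≡⟨ sym (%-absorbˡ d a) ⟩
      (d % ℓ + a) % ℓ          ≡⟨ cong (λ z → (z + a) % ℓ) (sym (res-spec c d)) ⟩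
      ((r₂ + c) % ℓ + a) % ℓ   ≡⟨ %-absorbˡ (r₂ + c) a ⟩
      (r₂ + c + a) % ℓ         ≡⟨ cong (_% ℓ) (+-*-Solver.solve 3 (λ r c a → r :+ c :+ a := r :+ (a :+ c)) refl r₂ c a) ⟩
      (r₂ + (a + c)) % ℓ       ∎

  hook-sum : ∀ ν a b → b ≤ row ν a → a ≤ col ν b → hook ν a b + (b + a) ≡ row ν a + col ν b + 1
  hook-sum ν a b b≤u a≤v = begin
    (u ∸ b) + (v ∸ a) + 1 + (b + a)   ≡⟨ +-*-Solver.solve 4 (λ x y b a → x :+ y :+ con 1 :+ (b :+ a) := (x :+ b) :+ (y :+ a) :+ con 1)
                                           refl (u ∸ b) (v ∸ a) b a ⟩
    (u ∸ b + b) + (v ∸ a + a) + 1     ≡⟨ cong₂ (λ x y → x + y + 1) (m∸n+n≡m b≤u) (m∸n+n≡m a≤v) ⟩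
    u + v + 1                         ∎
    where
    open ≡-Reasoning
    open +-*-Solver using (_:+_; _:=_; con)
    u = row ν a
    v = col ν b

  private
    hook-difference : ∀ ν a b → b ≤ row ν a → a ≤ col ν b → row ν a + col ν b + 1 ∸ (b + a) ≡ hook ν a b
    hook-difference ν a b b≤u a≤v =
      trans (cong (_∸ (b + a)) (sym (hook-sum ν a b b≤u a≤v))) (m+n∸n≡m (hook ν a b) (b + a))

    hook-corner≤ : ∀ ν a b → b ≤ row ν a → a ≤ col ν b → b + a ≤ row ν a + col ν b + 1
    hook-corner≤ ν a b b≤u a≤v = subst (b + a ≤_) (hook-sum ν a b b≤u a≤v) (m≤n+m (b + a) (hook ν a b))

  hook-∣⇒≈ : ∀ ν a b → b ≤ row ν a → a ≤ col ν b → ℓ ∣ hook ν a b → row ν a + col ν b + 1 ≈ b + a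
  hook-∣⇒≈ ν a b b≤u a≤v ℓ∣h =
    ∣∸⇒≈ (row ν a + col ν b + 1) (b + a) (hook-corner≤ ν a b b≤u a≤v)
         (subst (ℓ ∣_) (sym (hook-difference ν a b b≤u a≤v)) ℓ∣h)

  ≈⇒hook-∣ : ∀ ν a b → b ≤ row ν a → a ≤ col ν b → row ν a + col ν b + 1 ≈ b + a → ℓ ∣ hook ν a b
  ≈⇒hook-∣ ν a b b≤u a≤v ≈ =
    subst (ℓ ∣_) (hook-difference ν a b b≤u a≤v) (≈⇒∣∸ (row ν a + col ν b + 1) (b + a) (hook-corner≤ ν a b b≤u a≤v) ≈)

  1≉0 : 1 ≤ m → ¬ (1 ≈ 0)
  1≉0 1≤m 1≈0 with () ← trans (sym (m<n⇒m%n≡m (s≤s 1≤m))) 1≈0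

  res-right≢ : 1 ≤ m → ∀ a b → res ℓ a (suc b) ≢ res ℓ a b
  res-right≢ 1≤m a b e = 1≉0 1≤m (≈-cancelʳ 1 0 (b + a) (res⇒≈ a (suc b) a b e))

  res-below≢ : 1 ≤ m → ∀ a b → res ℓ (suc a) b ≢ res ℓ a b
  res-below≢ 1≤m a b e =
    1≉0 1≤m (≈-cancelʳ 1 0 (b + a) (trans (cong (_% ℓ) (sym (+-suc b a))) (sym (res⇒≈ (suc a) b a b e))))

box⇒≤col : ∀ {ν} → WF ν → ∀ a b → 1 ≤ a → 1 ≤ b → b ≤ row ν a → a ≤ col ν b
box⇒≤col {ν} w a b 1≤a 1≤b b≤r with a ≤? col ν b
... | yes a≤c = a≤c
... | no  a≰c = ⊥-elim (<⇒≱ (proj₂ (col-spec w b 1≤b)) (≤-trans b≤r (row-antitone w (suc (col ν b)) a (s≤s z≤n) (≰⇒> a≰c))))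

-- Otherwise the box in the row of the upper one and the column of the lower one has
-- a hook length divisible by ℓ.
module _ (m : ℕ) (1≤m : 1 ≤ m) where
  open Residues m

  core-addable-removable : ∀ {λ′} → WF λ′ → IsCore ℓ λ′ → ∀ a b c d →
    addable λ′ a b ≡ true → removable λ′ c d ≡ true → res ℓ a b ≢ res ℓ c d
  core-addable-removable {λ′} w core a b c d add rem same
    with addable⇒ λ′ a b add | removable⇒ λ′ c d rem
  ... | 1≤a , refl , grow | 1≤c , 1≤d , refl , below with <-cmp c a
  ... | tri≈ _ refl _ = res-right≢ 1≤m c (row λ′ c) same
  ... | tri< c<a _ _ = core c b (⇒inDiag λ′ c b 1≤c (s≤s z≤n) b≤λc) (≈⇒hook-∣ λ′ c b b≤λc c≤col hookCong)
    where
    up : suc (row λ′ a) ≤ row λ′ (a ∸ 1)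
    up = lower grow
      where
      lower : CanGrow λ′ a → suc (row λ′ a) ≤ row λ′ (a ∸ 1)
      lower (inj₁ refl) = ⊥-elim (<⇒≱ c<a 1≤c)
      lower (inj₂ le)   = le
    pa : suc (a ∸ 1) ≡ a
    pa = m+[n∸m]≡n 1≤a
    b≤λc : b ≤ row λ′ c
    b≤λc = ≤-trans up (row-antitone w c (a ∸ 1) 1≤c (∸-monoˡ-≤ 1 c<a))
    colb : col λ′ b ≡ a ∸ 1
    colb = col-unique w (a ∸ 1) b (s≤s z≤n) (inj₂ up) (subst (λ z → row λ′ z < b) (sym pa) ≤-refl)
    c≤col : c ≤ col λ′ b
    c≤col = subst (c ≤_) (sym colb) (∸-monoˡ-≤ 1 c<a)
    hookCong : row λ′ c + col λ′ b + 1 ≈ b + c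
    hookCong = begin
      (row λ′ c + col λ′ b + 1) % ℓ   ≡⟨ cong (λ z → (row λ′ c + z + 1) % ℓ) colb ⟩
      (row λ′ c + (a ∸ 1) + 1) % ℓ    ≡⟨ cong (_% ℓ) (trans (+-assoc (row λ′ c) _ 1) (cong (row λ′ c +_) (trans (+-comm _ 1) pa))) ⟩
      (row λ′ c + a) % ℓ              ≡⟨ sym (res⇒≈ a b c (row λ′ c) same) ⟩
      (b + c) % ℓ                     ∎
      where open ≡-Reasoning
  ... | tri> _ _ a<c = core a (row λ′ c) (⇒inDiag λ′ a (row λ′ c) 1≤a 1≤d λc≤λa) (≈⇒hook-∣ λ′ a (row λ′ c) λc≤λa a≤col hookCong)
    where
    λc≤λa : row λ′ c ≤ row λ′ a
    λc≤λa = row-antitone w a c 1≤a (<⇒≤ a<c)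
    colλc : col λ′ (row λ′ c) ≡ c
    colλc = col-unique w c (row λ′ c) 1≤d (inj₂ ≤-refl) below
    a≤col : a ≤ col λ′ (row λ′ c)
    a≤col = subst (a ≤_) (sym colλc) (<⇒≤ a<c)
    hookCong : row λ′ a + col λ′ (row λ′ c) + 1 ≈ row λ′ c + a
    hookCong = begin
      (row λ′ a + col λ′ (row λ′ c) + 1) % ℓ  ≡⟨ cong (λ z → (row λ′ a + z + 1) % ℓ) colλc ⟩
      (row λ′ a + c + 1) % ℓ                  ≡⟨ cong (_% ℓ) (+-comm (row λ′ a + c) 1) ⟩
      (suc (row λ′ a) + c) % ℓ                ≡⟨ res⇒≈ a (suc (row λ′ a)) c (row λ′ c) same ⟩
      (row λ′ c + a) % ℓ                      ∎
      where open ≡-Reasoning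

plusAt minusAt : Pos → Sign × Pos
plusAt p  = plus , p
minusAt p = minus , p

pluses minuses : Sig → List Pos
pluses []                 = []
pluses ((plus , p) ∷ s)   = p ∷ pluses s
pluses ((minus , _) ∷ s)  = pluses s
minuses []                = []
minuses ((plus , _) ∷ s)  = minuses s
minuses ((minus , p) ∷ s) = p ∷ minuses s

pluses-++ : ∀ s t → pluses (s ++ t) ≡ pluses s ++ pluses t
pluses-++ []                t = refl
pluses-++ ((plus , p) ∷ s)  t = cong (p ∷_) (pluses-++ s t)
pluses-++ ((minus , _) ∷ s) t = pluses-++ s t

minuses-++ : ∀ s t → minuses (s ++ t) ≡ minuses s ++ minuses t
minuses-++ []                t = refl
minuses-++ ((plus , _) ∷ s)  t = minuses-++ s t
minuses-++ ((minus , p) ∷ s) t = cong (p ∷_) (minuses-++ s t)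

sorted : List Pos → List Pos → Sig
sorted P M = map plusAt P ++ map minusAt M

pluses-sorted : ∀ P M → pluses (sorted P M) ≡ P
pluses-sorted (p ∷ P) M       = cong (p ∷_) (pluses-sorted P M)
pluses-sorted []      []      = refl
pluses-sorted []      (q ∷ M) = pluses-sorted [] M

sorted-if-pure : ∀ s → pluses s ≡ [] ⊎ minuses s ≡ [] → s ≡ sorted (pluses s) (minuses s)
sorted-if-pure s (inj₁ e) rewrite e = onlyMinus s e
  where
  onlyMinus : ∀ s → pluses s ≡ [] → s ≡ map minusAt (minuses s)
  onlyMinus []                _ = refl
  onlyMinus ((minus , p) ∷ s) e = cong (minusAt p ∷_) (onlyMinus s e)
sorted-if-pure s (inj₂ e) rewrite e = trans (onlyPlus s e) (sym (++-identityʳ _))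
  where
  onlyPlus : ∀ s → minuses s ≡ [] → s ≡ map plusAt (pluses s)
  onlyPlus []               _ = refl
  onlyPlus ((plus , p) ∷ s) e = cong (plusAt p ∷_) (onlyPlus s e)

conormal-sorted : ∀ P M → conormal (sorted P M) ≡ P
conormal-sorted P M = trans (cong (concatMap _) (iterate-fixed (length (sorted P M)) (cancelStep-sorted P M)))
                            (keepPluses _ (λ _ → refl) (λ _ → refl) P M)
  where
  cancelStep-sorted : ∀ P M → cancelStep (sorted P M) ≡ sorted P M
  cancelStep-sorted (p ∷ P) M            = cong (plusAt p ∷_) (cancelStep-sorted P M)
  cancelStep-sorted []      []           = refl
  cancelStep-sorted []      (q ∷ [])     = refl
  cancelStep-sorted []      (q ∷ q′ ∷ M) = cong (minusAt q ∷_) (cancelStep-sorted [] (q′ ∷ M))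
  iterate-fixed : ∀ n {s} → cancelStep s ≡ s → iterate n cancelStep s ≡ s
  iterate-fixed zero    _ = refl
  iterate-fixed (suc n) e rewrite e = iterate-fixed n e
  keepPluses : (keep : Sign × Pos → List Pos) → (∀ p → keep (plusAt p) ≡ p ∷ []) → (∀ p → keep (minusAt p) ≡ []) →
               ∀ P M → concatMap keep (sorted P M) ≡ P
  keepPluses keep kp km (p ∷ P) M       rewrite kp p = cong (p ∷_) (keepPluses keep kp km P M)
  keepPluses keep kp km []      []      = refl
  keepPluses keep kp km []      (q ∷ M) rewrite km q = keepPluses keep kp km [] M

lastM-snoc : ∀ P p → lastM (P ++ p ∷ []) ≡ just p
lastM-snoc []          p = refl
lastM-snoc (x ∷ [])    p = refl
lastM-snoc (x ∷ y ∷ P) p = lastM-snoc (y ∷ P) p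

module Signatures (m : ℕ) (1≤m : 1 ≤ m) (i : ℕ) where
  open Residues m

  entryOf : Pos → Bool → Bool → Bool → Sig
  entryOf p isI add rem = if isI then (if add then plusAt p ∷ [] else (if rem then minusAt p ∷ [] else [])) else []

  entry : Partition → Pos → Sig
  entry μ (a , b) = entryOf (a , b) (res ℓ a b ≡ᵇ i) (addable μ a b) (removable μ a b)

  signature-entries : ∀ μ O → signature ℓ μ i O ≡ concatMap (entry μ) O
  signature-entries μ []      = refl
  signature-entries μ (p ∷ O) = cong (entry μ p ++_) (signature-entries μ O)

  AddI RemI : Partition → Pos → Set
  AddI μ (a , b) = addable μ a b ≡ true × res ℓ a b ≡ i
  RemI μ (a , b) = removable μ a b ≡ true × res ℓ a b ≡ i

  data EntryShape (μ : Partition) (p : Pos) : Set where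
    blank : entry μ p ≡ [] → EntryShape μ p
    plus  : entry μ p ≡ plusAt p ∷ [] → AddI μ p → EntryShape μ p
    minus : entry μ p ≡ minusAt p ∷ [] → RemI μ p → EntryShape μ p

  entry-shape : ∀ μ p → EntryShape μ p
  entry-shape μ (a , b) = decide (res ℓ a b ≡ᵇ i) (addable μ a b) (removable μ a b) refl refl refl
    where
    same : ∀ {x y z} → (res ℓ a b ≡ᵇ i) ≡ x → addable μ a b ≡ y → removable μ a b ≡ z →
           entry μ (a , b) ≡ entryOf (a , b) x y z
    same refl refl refl = refl
    decide : ∀ x y z → (res ℓ a b ≡ᵇ i) ≡ x → addable μ a b ≡ y → removable μ a b ≡ z → EntryShape μ (a , b)
    decide false y     z     e₁ e₂ e₃ = blank (same e₁ e₂ e₃)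
    decide true  true  z     e₁ e₂ e₃ = plus  (same e₁ e₂ e₃) (e₂ , ≡ᵇ⇒≡′ e₁)
    decide true  false true  e₁ e₂ e₃ = minus (same e₁ e₂ e₃) (e₃ , ≡ᵇ⇒≡′ e₁)
    decide true  false false e₁ e₂ e₃ = blank (same e₁ e₂ e₃)

  entry-addI : ∀ μ a b → AddI μ (a , b) → entry μ (a , b) ≡ plusAt (a , b) ∷ []
  entry-addI μ a b (add , r) rewrite add | r | ≡ᵇ-refl i = refl

  pluses-AddI : ∀ μ O → All (AddI μ) (pluses (concatMap (entry μ) O))
  pluses-AddI μ []      = []
  pluses-AddI μ (p ∷ O) rewrite pluses-++ (entry μ p) (concatMap (entry μ) O) with entry-shape μ p
  ... | blank e   rewrite e = pluses-AddI μ O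
  ... | plus e ai rewrite e = ai ∷ pluses-AddI μ O
  ... | minus e _ rewrite e = pluses-AddI μ O

  minuses-RemI : ∀ μ O → All (RemI μ) (minuses (concatMap (entry μ) O))
  minuses-RemI μ []      = []
  minuses-RemI μ (p ∷ O) rewrite minuses-++ (entry μ p) (concatMap (entry μ) O) with entry-shape μ p
  ... | blank e    rewrite e = minuses-RemI μ O
  ... | plus e _   rewrite e = minuses-RemI μ O
  ... | minus e ri rewrite e = ri ∷ minuses-RemI μ O

  -- On a core there are never both pluses and minuses, so every signature is sorted.
  core-signature-sorted : ∀ {λ′} → WF λ′ → IsCore ℓ λ′ → ∀ O →
    concatMap (entry λ′) O ≡ sorted (pluses (concatMap (entry λ′) O)) (minuses (concatMap (entry λ′) O))
  core-signature-sorted {λ′} w core O = sorted-if-pure _ (pure (pluses-AddI λ′ O) (minuses-RemI λ′ O))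
    where
    pure : ∀ {P M} → All (AddI λ′) P → All (RemI λ′) M → P ≡ [] ⊎ M ≡ []
    pure []                                _                         = inj₁ refl
    pure (_ ∷ _)                           []                        = inj₂ refl
    pure {(a , b) ∷ _} {(c , d) ∷ _} ((add , ra) ∷ _) ((rem , rc) ∷ _) =
      ⊥-elim (core-addable-removable m 1≤m w core a b c d add rem (trans ra (sym rc)))

  isAddI : Partition → Pos → ℕ
  isAddI μ p = length (pluses (entry μ p))

  isAddI-cases : ∀ μ p → isAddI μ p ≡ 0 ⊎ (isAddI μ p ≡ 1 × AddI μ p)
  isAddI-cases μ p with entry-shape μ p
  ... | blank e   rewrite e = inj₁ refl
  ... | plus e ai rewrite e = inj₂ (refl , ai)
  ... | minus e _ rewrite e = inj₁ refl

  isAddI-AddI : ∀ μ p → AddI μ p → isAddI μ p ≡ 1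
  isAddI-AddI μ (a , b) ai rewrite entry-addI μ a b ai = refl

  sumBy-pluses : ∀ μ (w : Pos → ℕ) O → sumBy w (pluses (concatMap (entry μ) O)) ≡ sumBy (λ p → w p * isAddI μ p) O
  sumBy-pluses μ w []      = refl
  sumBy-pluses μ w (p ∷ O) = begin
    sumBy w (pluses (entry μ p ++ concatMap (entry μ) O))
      ≡⟨ cong (sumBy w) (pluses-++ (entry μ p) _) ⟩
    sumBy w (pluses (entry μ p) ++ pluses (concatMap (entry μ) O))
      ≡⟨ sumBy-++ w (pluses (entry μ p)) _ ⟩
    sumBy w (pluses (entry μ p)) + sumBy w (pluses (concatMap (entry μ) O))
      ≡⟨ cong₂ _+_ (single (entry-shape μ p)) (sumBy-pluses μ w O) ⟩
    w p * isAddI μ p + sumBy (λ p → w p * isAddI μ p) O ∎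
    where
    open ≡-Reasoning
    single : EntryShape μ p → sumBy w (pluses (entry μ p)) ≡ w p * isAddI μ p
    single (blank e)   rewrite e = sym (*-zeroʳ (w p))
    single (plus e _)  rewrite e = trans (+-identityʳ _) (sym (*-identityʳ _))
    single (minus e _) rewrite e = sym (*-zeroʳ (w p))

  length≡sumBy1 : (L : List A) → length L ≡ sumBy (λ _ → 1) L
  length≡sumBy1 []      = refl
  length≡sumBy1 (x ∷ L) = cong suc (length≡sumBy1 L)

  mult-pluses≤ : ∀ μ q O → mult q (pluses (concatMap (entry μ) O)) ≤ mult q O
  mult-pluses≤ μ q O rewrite sumBy-pluses μ (λ x → δ₂ x q) O =
    sumBy-mono (λ p → ≤-trans (*-monoʳ-≤ (δ₂ p q) (isAddI≤1 p)) (≤-reflexive (*-identityʳ _))) O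
    where
    isAddI≤1 : ∀ p → isAddI μ p ≤ 1
    isAddI≤1 p with isAddI-cases μ p
    ... | inj₁ e       rewrite e = z≤n
    ... | inj₂ (e , _) rewrite e = ≤-refl

  samePos : Pos → Pos → Bool
  samePos (a , b) (c , d) = (a ≡ᵇ c) ∧ (b ≡ᵇ d)

  samePos-refl : ∀ p → samePos p p ≡ true
  samePos-refl (a , b) rewrite ≡ᵇ-refl a | ≡ᵇ-refl b = refl

  samePos-≢ : ∀ {p q} → p ≢ q → samePos p q ≡ false
  samePos-≢ {a , b} {c , d} p≢q with a ≟ c | b ≟ d
  ... | no a≢c   | _        rewrite ≢⇒≡ᵇ-false a≢c = refl
  ... | yes refl | no b≢d   rewrite ≡ᵇ-refl a | ≢⇒≡ᵇ-false b≢d = refl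
  ... | yes refl | yes refl = ⊥-elim (p≢q refl)

  flipAt : Pos → Sign × Pos → Sign × Pos
  flipAt p (s , q) = if samePos q p then minusAt q else (s , q)

  flipAt-pluses : ∀ p L → mult p L ≡ 0 → map (flipAt p) (map plusAt L) ≡ map plusAt L
  flipAt-pluses p []      _ = refl
  flipAt-pluses (c , d) ((a , b) ∷ L) e rewrite samePos-≢ (δ₂≡0⇒≢ {a , b} {c , d} (m+n≡0⇒m≡0 (δ₂ (a , b) (c , d)) e)) =
    cong (plusAt (a , b) ∷_) (flipAt-pluses (c , d) L (m+n≡0⇒n≡0 (δ₂ (a , b) (c , d)) e))

  flipAt-minuses : ∀ p M → map (flipAt p) (map minusAt M) ≡ map minusAt M
  flipAt-minuses p []      = refl
  flipAt-minuses (c , d) ((a , b) ∷ M) with samePos (a , b) (c , d)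
  ... | true  = cong (minusAt (a , b) ∷_) (flipAt-minuses (c , d) M)
  ... | false = cong (minusAt (a , b) ∷_) (flipAt-minuses (c , d) M)

  flipAt-sorted : ∀ P p M → mult p P ≡ 0 → map (flipAt p) (sorted (P ++ p ∷ []) M) ≡ sorted P (p ∷ M)
  flipAt-sorted P p M p∉P = begin
    map (flipAt p) (map plusAt (P ++ p ∷ []) ++ map minusAt M)
      ≡⟨ map-++ (flipAt p) (map plusAt (P ++ p ∷ [])) _ ⟩
    map (flipAt p) (map plusAt (P ++ p ∷ [])) ++ map (flipAt p) (map minusAt M)
      ≡⟨ cong₂ _++_ (cong (map (flipAt p)) (map-++ plusAt P (p ∷ []))) (flipAt-minuses p M) ⟩
    map (flipAt p) (map plusAt P ++ plusAt p ∷ []) ++ map minusAt M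
      ≡⟨ cong (_++ map minusAt M) (map-++ (flipAt p) (map plusAt P) (plusAt p ∷ [])) ⟩
    (map (flipAt p) (map plusAt P) ++ flipAt p (plusAt p) ∷ []) ++ map minusAt M
      ≡⟨ cong₂ (λ u v → (u ++ v ∷ []) ++ map minusAt M) (flipAt-pluses p P p∉P) flipped ⟩
    (map plusAt P ++ minusAt p ∷ []) ++ map minusAt M
      ≡⟨ ++-assoc (map plusAt P) (minusAt p ∷ []) (map minusAt M) ⟩
    sorted P (p ∷ M) ∎
    where
    open ≡-Reasoning
    flipped : flipAt p (plusAt p) ≡ minusAt p
    flipped rewrite samePos-refl p = refl

  -- Adding an addable i-box p = (a , λ_a + 1) turns the entry at p from + into −
  -- and leaves every other entry unchanged, because the neighbours of p do not
  -- have residue i.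
  module AddBox (μ : Partition) (w : WF μ) (a : ℕ) (ai : AddI μ (a , suc (row μ a))) where
    b : ℕ
    b = suc (row μ a)

    p : Pos
    p = a , b

    μ⁺ : Partition
    μ⁺ = addRow a μ

    1≤a : 1 ≤ a
    1≤a = proj₁ (addable⇒ μ a b (proj₁ ai))

    a≤ : a ≤ suc (length μ)
    a≤ = addable-row≤ w a b (proj₁ ai)

    μ⁺-WF : WF μ⁺
    μ⁺-WF = addRow-WF w a 1≤a a≤ (proj₂ (proj₂ (addable⇒ μ a b (proj₁ ai))))

    μ⁺-row : ∀ x → row μ⁺ x ≡ row μ x + δ a x
    μ⁺-row = addRow-row μ a 1≤a a≤

    μ⁺-row-a : row μ⁺ a ≡ b
    μ⁺-row-a rewrite μ⁺-row a | δ-refl a = +-comm (row μ a) 1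

    p-not-addable : addable μ⁺ a b ≡ false
    p-not-addable with addable μ⁺ a b in e
    ... | false = refl
    ... | true  = ⊥-elim (1+n≰n (≤-reflexive (sym (trans (proj₁ (proj₂ (addable⇒ μ⁺ a b e))) (cong suc μ⁺-row-a)))))

    p-removable : removable μ⁺ a b ≡ true
    p-removable = subst (λ z → removable μ⁺ a z ≡ true) μ⁺-row-a
      (⇒removable μ⁺ a 1≤a (subst (1 ≤_) (sym μ⁺-row-a) (s≤s z≤n)) shorterBelow)
      where
      shorterBelow : row μ⁺ (suc a) < row μ⁺ a
      shorterBelow rewrite μ⁺-row-a | μ⁺-row (suc a) | δ-≢ (<⇒≢ (n<1+n a)) | +-identityʳ (row μ (suc a)) =
        s≤s (row-antitone w a (suc a) 1≤a (n≤1+n a))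

    unchanged : ∀ x y → (x , y) ≢ p → inDiag μ⁺ x y ≡ inDiag μ x y
    unchanged = inDiag-addRow μ a 1≤a a≤

    off-residue : ∀ x y → res ℓ x y ≢ i → (x , y) ≢ p
    off-residue x y r≢i refl = r≢i (proj₂ ai)

    module Neighbours (c d : ℕ) (rq : res ℓ c d ≡ i) where
      above : (c ∸ 1 , d) ≢ p
      above = up c rq
        where
        up : ∀ c → res ℓ c d ≡ i → (c ∸ 1 , d) ≢ p
        up zero     _  e = <⇒≢ 1≤a (,-injectiveˡ e)
        up (suc c′) rq = off-residue c′ d (λ r → res-below≢ 1≤m c′ d (trans rq (sym r)))
      left : (c , d ∸ 1) ≢ p
      left = lf d rq
        where
        lf : ∀ d → res ℓ c d ≡ i → (c , d ∸ 1) ≢ p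
        lf zero     _  e = 1+n≢0 (sym (,-injectiveʳ e))
        lf (suc d′) rq = off-residue c d′ (λ r → res-right≢ 1≤m c d′ (trans rq (sym r)))
      below : (suc c , d) ≢ p
      below = off-residue (suc c) d (λ r → res-below≢ 1≤m c d (trans r (sym rq)))
      right : (c , suc d) ≢ p
      right = off-residue c (suc d) (λ r → res-right≢ 1≤m c d (trans r (sym rq)))

    entry-elsewhere : ∀ c d → res ℓ c d ≡ i → (c , d) ≢ p →
      entryOf (c , d) true (addable μ⁺ c d) (removable μ⁺ c d) ≡
      map (flipAt p) (entryOf (c , d) true (addable μ c d) (removable μ c d))
    entry-elsewhere c d rq q≢p
      rewrite addable-cong μ μ⁺ c d (unchanged c d q≢p) (unchanged (c ∸ 1) d (Neighbours.above c d rq))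
                                    (unchanged c (d ∸ 1) (Neighbours.left c d rq))
            | removable-cong μ μ⁺ c d (unchanged c d q≢p) (unchanged (suc c) d (Neighbours.below c d rq))
                                      (unchanged c (suc d) (Neighbours.right c d rq))
      with addable μ c d | removable μ c d
    ... | true  | _     rewrite samePos-≢ q≢p = refl
    ... | false | true  rewrite samePos-≢ q≢p = refl
    ... | false | false = refl

    entry-after : ∀ q → entry μ⁺ q ≡ map (flipAt p) (entry μ q)
    entry-after (c , d) with res ℓ c d ≡ᵇ i in rq
    ... | false = refl
    ... | true with c ≟ a | d ≟ b
    ...   | yes refl | yes refl rewrite p-not-addable | p-removable | proj₁ ai | samePos-refl p = refl
    ...   | yes refl | no d≢b   = entry-elsewhere c d (≡ᵇ⇒≡′ rq) (λ e → d≢b (,-injectiveʳ e))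
    ...   | no c≢a   | _        = entry-elsewhere c d (≡ᵇ⇒≡′ rq) (λ e → c≢a (,-injectiveˡ e))

  crystalOp : (Partition → List Pos) → Partition → Maybe Partition
  crystalOp order μ = addPos μ (lastM (conormal (signature ℓ μ i (order μ))))

  record Reading (order : Partition → List Pos) (B : ℕ) : Set where
    field
      grid   : List Pos
      reads  : ∀ μ → WF μ → suc (length μ) ≤ B → suc (row μ 1) ≤ B →
               signature ℓ μ i (order μ) ≡ concatMap (entry μ) grid
      once   : ∀ q → mult q grid ≤ 1
      covers : ∀ x y → 1 ≤ x → x ≤ B → 1 ≤ y → y ≤ B → mult (x , y) grid ≡ 1

  inRow : ℕ → List Pos → ℕ
  inRow x = sumBy (λ q → δ (proj₁ q) x)

  module Steps {order : Partition → List Pos} {B : ℕ} (reading : Reading order B) where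
    open Reading reading

    -- The last plus p of a sorted grid signature is an addable i-box, and (as the grid
    -- lists p once) it is not among the earlier pluses.
    last-plus : ∀ μ P p M → concatMap (entry μ) grid ≡ sorted (P ++ p ∷ []) M → AddI μ p × mult p P ≡ 0
    last-plus μ P p M sig = lastAddI , p∉P
      where
      plusesμ : pluses (concatMap (entry μ) grid) ≡ P ++ p ∷ []
      plusesμ = trans (cong pluses sig) (pluses-sorted (P ++ p ∷ []) M)
      lastAddI : AddI μ p
      lastAddI with ++⁻ʳ P (subst (All (AddI μ)) plusesμ (pluses-AddI μ grid))
      ... | ai ∷ _ = ai
      count : mult p (P ++ p ∷ []) ≡ suc (mult p P)
      count = trans (sumBy-++ (λ x → δ₂ x p) P (p ∷ []))
                    (trans (cong (λ z → mult p P + (z + 0)) (δ₂-refl p)) (+-comm (mult p P) 1))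
      p∉P : mult p P ≡ 0
      p∉P = n≤0⇒n≡0 (≤-pred (subst (_≤ 1) count (≤-trans (≤-reflexive (cong (mult p) (sym plusesμ)))
                                                           (≤-trans (mult-pluses≤ μ p grid) (once p)))))

    crystal-step : ∀ μ P a b M → WF μ → suc (length μ) ≤ B → suc (row μ 1) ≤ B →
      concatMap (entry μ) grid ≡ sorted (P ++ (a , b) ∷ []) M → crystalOp order μ ≡ just (addRow a μ)
    crystal-step μ P a b M w lenB rowB sig = begin
      crystalOp order μ                                          ≡⟨ cong (λ s → addPos μ (lastM (conormal s))) (trans (reads μ w lenB rowB) sig) ⟩
      addPos μ (lastM (conormal (sorted (P ++ (a , b) ∷ []) M))) ≡⟨ cong (λ z → addPos μ (lastM z)) (conormal-sorted (P ++ (a , b) ∷ []) M) ⟩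
      addPos μ (lastM (P ++ (a , b) ∷ []))                       ≡⟨ cong (addPos μ) (lastM-snoc P (a , b)) ⟩
      just (addRow a μ)                                          ∎
      where open ≡-Reasoning

    -- When the signature of μ is sorted with pluses Q (last one first), |Q| crystal
    -- steps add exactly the boxes of Q, one at a time from the right; each step turns
    -- the added box into the first minus.
    add-pluses : ∀ Q μ M → WF μ → length μ + length Q < B → row μ 1 + length Q < B →
      concatMap (entry μ) grid ≡ sorted (reverse Q) M →
      Σ Partition λ ν → (crystalOp order ^[ length Q ] just μ ≡ just ν) × WF ν × (∀ x → row ν x ≡ row μ x + inRow x Q)
    add-pluses []      μ M w _ _ _ = μ , refl , w , λ x → sym (+-identityʳ _)
    add-pluses ((a , b) ∷ Q) μ M w lenB rowB sig = continue (addable⇒ μ a b (proj₁ (proj₁ last))) (proj₁ last)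
      where
      P = reverse Q
      sig′ : concatMap (entry μ) grid ≡ sorted (P ++ (a , b) ∷ []) M
      sig′ = trans sig (cong (λ z → sorted z M) (unfold-reverse (a , b) Q))
      last = last-plus μ P (a , b) M sig′
      fits : ∀ {u} → u + suc (length Q) < B → suc u ≤ B
      fits {u} lt = ≤-trans (s≤s (m≤m+n u (suc (length Q)))) lt
      continue : 1 ≤ a × b ≡ suc (row μ a) × CanGrow μ a → AddI μ (a , b) →
        Σ Partition λ ν → (crystalOp order ^[ suc (length Q) ] just μ ≡ just ν) × WF ν × (∀ x → row ν x ≡ row μ x + inRow x ((a , b) ∷ Q))
      continue (_ , refl , _) ai = ν , iterates , proj₁ (proj₂ (proj₂ rest)) , rows
        where
        open AddBox μ w a ai using (μ⁺; μ⁺-WF; μ⁺-row; entry-after)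
        sig⁺ : concatMap (entry μ⁺) grid ≡ sorted P ((a , b) ∷ M)
        sig⁺ = begin
          concatMap (entry μ⁺) grid                               ≡⟨ concatMap-cong entry-after grid ⟩
          concatMap (λ q → map (flipAt (a , b)) (entry μ q)) grid ≡⟨ sym (map-concatMap (flipAt (a , b)) (entry μ) grid) ⟩
          map (flipAt (a , b)) (concatMap (entry μ) grid)         ≡⟨ cong (map (flipAt (a , b))) sig′ ⟩
          map (flipAt (a , b)) (sorted (P ++ (a , b) ∷ []) M)     ≡⟨ flipAt-sorted P (a , b) M (proj₂ last) ⟩
          sorted P ((a , b) ∷ M)                                  ∎
          where open ≡-Reasoning
        lenB⁺ : length μ⁺ + length Q < B
        lenB⁺ = ≤-trans (s≤s (≤-trans (+-monoˡ-≤ (length Q) (addRow-length μ a)) (≤-reflexive (sym (+-suc (length μ) (length Q)))))) lenB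
        rowB⁺ : row μ⁺ 1 + length Q < B
        rowB⁺ = ≤-trans (s≤s (≤-trans (+-monoˡ-≤ (length Q) (addRow-row₁ μ a)) (≤-reflexive (sym (+-suc (row μ 1) (length Q)))))) rowB
        rest = add-pluses Q μ⁺ ((a , b) ∷ M) μ⁺-WF lenB⁺ rowB⁺ sig⁺
        ν = proj₁ rest
        iterates : crystalOp order ^[ suc (length Q) ] just μ ≡ just ν
        iterates rewrite crystal-step μ P a b M w (fits lenB) (fits rowB) sig′ = proj₁ (proj₂ rest)
        rows : ∀ x → row ν x ≡ row μ x + inRow x ((a , b) ∷ Q)
        rows x rewrite proj₂ (proj₂ (proj₂ rest)) x | μ⁺-row x = +-assoc (row μ x) (δ a x) (inRow x Q)

  growsI : Partition → ℕ → ℕ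
  growsI μ x = isAddI μ (x , suc (row μ x))

  module OnCore (λ′ : Partition) (w : WF λ′) (core : IsCore ℓ λ′)
                {order : Partition → List Pos} {B : ℕ} (reading : Reading order B)
                (lenB : length λ′ + length (pluses (signature ℓ λ′ i (order λ′))) < B)
                (rowB : row λ′ 1 + length (pluses (signature ℓ λ′ i (order λ′))) < B) where
    open Reading reading

    s : Sig
    s = signature ℓ λ′ i (order λ′)

    P M : List Pos
    P = pluses s
    M = minuses s

    s-grid : s ≡ concatMap (entry λ′) grid
    s-grid = reads λ′ w (≤-trans (s≤s (m≤m+n _ _)) lenB) (≤-trans (s≤s (m≤m+n _ _)) rowB)

    s-sorted : s ≡ sorted P M
    s-sorted = trans s-grid (trans (core-signature-sorted w core grid)
                                   (cong₂ sorted (cong pluses (sym s-grid)) (cong minuses (sym s-grid))))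

    -- An addable i-box in row x can only be the end of row x.
    row-end : ∀ x q → δ (proj₁ q) x * isAddI λ′ q ≡ δ₂ q (x , suc (row λ′ x)) * growsI λ′ x
    row-end x (c , d) with isAddI-cases λ′ (c , d)
    ... | inj₂ (one , add , _) with addable⇒ λ′ c d add
    ...   | _ , refl , _ with c ≟ x
    ...     | yes refl rewrite one | δ-refl c | δ-refl (suc (row λ′ c)) = refl
    ...     | no  c≢x  rewrite one | δ-≢ c≢x = refl
    row-end x (c , d) | inj₁ none with c ≟ x | d ≟ suc (row λ′ x)
    ... | yes refl | yes refl rewrite none = trans (*-zeroʳ (δ c c)) (sym (*-zeroʳ (δ₂ (c , d) (c , d))))
    ... | yes refl | no  d≢   rewrite none | δ-≢ d≢ | *-zeroʳ (δ c c) = refl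
    ... | no  c≢x  | _        rewrite none | δ-≢ c≢x = refl

    row-end-in-grid : ∀ x → 1 ≤ x → x ≤ suc (length λ′) → mult (x , suc (row λ′ x)) grid ≡ 1
    row-end-in-grid x 1≤x x≤ = covers x (suc (row λ′ x)) 1≤x (≤-trans x≤ (≤-trans (s≤s (m≤m+n _ _)) lenB))
      (s≤s z≤n) (≤-trans (s≤s (row≤row₁ w x)) (≤-trans (s≤s (m≤m+n _ _)) rowB))

    inRow-grid : ∀ x → sumBy (λ q → δ (proj₁ q) x * isAddI λ′ q) grid ≡ growsI λ′ x
    inRow-grid x rewrite sumBy-cong (row-end x) grid | sumBy-*ʳ (λ q → δ₂ q (x , suc (row λ′ x))) (growsI λ′ x) grid
      with isAddI-cases λ′ (x , suc (row λ′ x))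
    ... | inj₁ none rewrite none = *-zeroʳ (mult (x , suc (row λ′ x)) grid)
    ... | inj₂ (one , add , _) rewrite one
        | row-end-in-grid x (proj₁ (addable⇒ λ′ x (suc (row λ′ x)) add)) (addable-row≤ w x (suc (row λ′ x)) add) = refl

    inRow-pluses : ∀ x → inRow x P ≡ growsI λ′ x
    inRow-pluses x = trans (cong (inRow x) (cong pluses s-grid)) (trans (sumBy-pluses λ′ (λ q → δ (proj₁ q) x) grid) (inRow-grid x))

    φ-count : length (conormal s) ≡ sumBy (growsI λ′) (oneTo B)
    φ-count = begin
      length (conormal s)                                   ≡⟨ cong length (trans (cong conormal s-sorted) (conormal-sorted P M)) ⟩
      length P                                              ≡⟨ trans (length≡sumBy1 P) (cong (sumBy (λ _ → 1)) (cong pluses s-grid)) ⟩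
      sumBy (λ _ → 1) (pluses (concatMap (entry λ′) grid))  ≡⟨ sumBy-pluses λ′ (λ _ → 1) grid ⟩
      sumBy (λ q → 1 * isAddI λ′ q) grid                    ≡⟨ sumBy-cong spread grid ⟩
      sumBy (λ q → sumBy (λ x → δ (proj₁ q) x * isAddI λ′ q) (oneTo B)) grid
                                                            ≡⟨ sumBy-swap (λ q x → δ (proj₁ q) x * isAddI λ′ q) grid (oneTo B) ⟩
      sumBy (λ x → sumBy (λ q → δ (proj₁ q) x * isAddI λ′ q) grid) (oneTo B)
                                                            ≡⟨ sumBy-cong inRow-grid (oneTo B) ⟩
      sumBy (growsI λ′) (oneTo B)                           ∎
      where
      open ≡-Reasoning
      -- an addable i-box lies in exactly one of the rows 1 … B
      spread : ∀ q → 1 * isAddI λ′ q ≡ sumBy (λ x → δ (proj₁ q) x * isAddI λ′ q) (oneTo B)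
      spread (c , d) rewrite sumBy-*ʳ (δ c) (isAddI λ′ (c , d)) (oneTo B) | sumBy-cong (δ-sym c) (oneTo B)
        with isAddI-cases λ′ (c , d)
      ... | inj₁ none rewrite none = sym (*-zeroʳ (multℕ c (oneTo B)))
      ... | inj₂ (one , add , _) rewrite one
          | multℕ-oneTo-in c B (proj₁ (addable⇒ λ′ c d add))
                            (≤-trans (addable-row≤ w c d add) (≤-trans (s≤s (m≤m+n _ _)) lenB)) = refl

    all-steps = Steps.add-pluses reading (reverse P) λ′ M w
                  (subst (λ z → length λ′ + z < B) (sym (length-reverse P)) lenB)
                  (subst (λ z → row λ′ 1 + z < B) (sym (length-reverse P)) rowB)
                  (trans (sym s-grid) (trans s-sorted (cong (λ z → sorted z M) (sym (reverse-involutive P)))))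

    result : Partition
    result = proj₁ all-steps

    result-reached : crystalOp order ^[ length (conormal s) ] just λ′ ≡ just result
    result-reached = subst (λ z → crystalOp order ^[ z ] just λ′ ≡ just result)
                           (trans (length-reverse P) (sym (cong length (trans (cong conormal s-sorted) (conormal-sorted P M)))))
                           (proj₁ (proj₂ all-steps))

    result-WF : WF result
    result-WF = proj₁ (proj₂ (proj₂ all-steps))

    result-row : ∀ x → row result x ≡ row λ′ x + growsI λ′ x
    result-row x = trans (proj₂ (proj₂ (proj₂ all-steps)) x) (cong (row λ′ x +_) (trans (sumBy-reverse _ P) (inRow-pluses x)))

  entry-outside : ∀ {μ} → WF μ → ∀ c d → gridR μ < c ⊎ gridC μ < d → entry μ (c , d) ≡ []
  entry-outside {μ} w c d out with entry-shape μ (c , d)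
  ... | blank e = e
  ... | plus _ (add , _) = ⊥-elim (beyond out (addable⇒ μ c d add))
    where
    beyond : gridR μ < c ⊎ gridC μ < d → ¬ (1 ≤ c × d ≡ suc (row μ c) × CanGrow μ c)
    beyond (inj₁ lt) (_ , _ , inj₁ refl) = <⇒≱ lt (s≤s z≤n)
    beyond (inj₁ lt) (_ , refl , inj₂ up) =
      <⇒≱ (s≤s z≤n) (subst (suc (row μ c) ≤_) (row-beyond μ (c ∸ 1) (∸-monoˡ-≤ 1 lt)) up)
    beyond (inj₂ lt) (_ , refl , _)      = <⇒≱ lt (s≤s (row≤row₁ w c))
  ... | minus _ (rem , _) with removable⇒ μ c d rem | out
  ...   | _ , 1≤d , refl , _ | inj₁ lt = ⊥-elim (<⇒≱ 1≤d (≤-reflexive (row-beyond μ c (<-trans (n<1+n _) lt))))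
  ...   | _ , _   , refl , _ | inj₂ lt = ⊥-elim (<⇒≱ lt (≤-trans (row≤row₁ w c) (n≤1+n _)))

  classicalGrid : ℕ → ℕ → List Pos
  classicalGrid R C = concatMap (λ a → map (λ b → (a , b)) (oneTo C)) (reverse (oneTo R))

  key : ℕ → ℕ → ℕ
  key c d = c + m * d

  onLadder : ℕ → ℕ → ℕ → List Pos
  onLadder k c d = if key c d ≡ᵇ k then (c , d) ∷ [] else []

  ladderGrid : ℕ → ℕ → ℕ → List Pos
  ladderGrid R C K = concatMap (λ k → concatMap (λ c → concatMap (onLadder k c) (oneTo C)) (oneTo R)) (oneTo K)

  module Stable {μ : Partition} (w : WF μ) where
    private
      gR gC gK : ℕ
      gR = gridR μ
      gC = gridC μ
      gK = gR + m * gC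

    classical-stable : ∀ R C → gR ≤ R → gC ≤ C →
      concatMap (entry μ) (classicalGrid R C) ≡ concatMap (entry μ) (classicalGrid gR gC)
    classical-stable R C gR≤R gC≤C = trans (byRows R C) (trans trimColumns (trans trimRows (sym (byRows gR gC))))
      where
      byRows : ∀ R C → concatMap (entry μ) (classicalGrid R C) ≡ concatMap (λ a → concatMap (λ b → entry μ (a , b)) (oneTo C)) (reverse (oneTo R))
      byRows R C = trans (concatMap-concatMap (entry μ) _ (reverse (oneTo R)))
                         (concatMap-cong (λ a → concatMap-map (entry μ) (λ b → (a , b)) (oneTo C)) (reverse (oneTo R)))
      trimColumns = concatMap-cong (λ a → concatMap-oneTo-trim (λ b → entry μ (a , b)) gC C gC≤C
                                          (λ d lt → entry-outside w a d (inj₂ lt))) (reverse (oneTo R))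
      trimRows = concatMap-revOneTo-trim (λ a → concatMap (λ b → entry μ (a , b)) (oneTo gC)) gR R gR≤R
                   (λ a lt → concatMap-[] _ (λ d → entry-outside w a d (inj₁ lt)) (oneTo gC))

    private
      ladderEntry : ℕ → ℕ → ℕ → Sig
      ladderEntry k c d = concatMap (entry μ) (onLadder k c d)

      ladderEntry-outside : ∀ k c d → gR < c ⊎ gC < d → ladderEntry k c d ≡ []
      ladderEntry-outside k c d out with key c d ≡ᵇ k
      ... | true  rewrite entry-outside w c d out = refl
      ... | false = refl

      ladderEntry-late : ∀ k c d → gK < k → ladderEntry k c d ≡ []
      ladderEntry-late k c d lt with key c d ≡ᵇ k in eq
      ... | false = refl
      ... | true with c ≤? gR | d ≤? gC
      ...   | yes c≤ | yes d≤ = ⊥-elim (<⇒≱ lt (subst (_≤ gK) (≡ᵇ⇒≡′ eq) (+-mono-≤ c≤ (*-monoʳ-≤ m d≤))))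
      ...   | no  c≰ | _      rewrite entry-outside w c d (inj₁ (≰⇒> c≰)) = refl
      ...   | yes _  | no d≰  rewrite entry-outside w c d (inj₂ (≰⇒> d≰)) = refl

    ladder-stable : ∀ R C K → gR ≤ R → gC ≤ C → gK ≤ K →
      concatMap (entry μ) (ladderGrid R C K) ≡ concatMap (entry μ) (ladderGrid gR gC gK)
    ladder-stable R C K gR≤R gC≤C gK≤K = trans (byLadders R C K) (trans trimColumns (trans trimRows (trans trimLadders (sym (byLadders gR gC gK)))))
      where
      byLadders : ∀ R C K → concatMap (entry μ) (ladderGrid R C K) ≡
        concatMap (λ k → concatMap (λ c → concatMap (ladderEntry k c) (oneTo C)) (oneTo R)) (oneTo K)
      byLadders R C K = trans (concatMap-concatMap (entry μ) _ (oneTo K))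
        (concatMap-cong (λ k → trans (concatMap-concatMap (entry μ) _ (oneTo R))
          (concatMap-cong (λ c → concatMap-concatMap (entry μ) _ (oneTo C)) (oneTo R))) (oneTo K))
      trimColumns = concatMap-cong (λ k → concatMap-cong (λ c → concatMap-oneTo-trim (ladderEntry k c) gC C gC≤C
                      (λ d lt → ladderEntry-outside k c d (inj₂ lt))) (oneTo R)) (oneTo K)
      trimRows = concatMap-cong (λ k → concatMap-oneTo-trim (λ c → concatMap (ladderEntry k c) (oneTo gC)) gR R gR≤R
                   (λ c lt → concatMap-[] (ladderEntry k c) (λ d → ladderEntry-outside k c d (inj₁ lt)) (oneTo gC))) (oneTo K)
      trimLadders = concatMap-oneTo-trim (λ k → concatMap (λ c → concatMap (ladderEntry k c) (oneTo gC)) (oneTo gR)) gK K gK≤K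
                      (λ k lt → concatMap-[] _ (λ c → concatMap-[] (ladderEntry k c) (λ d → ladderEntry-late k c d lt) (oneTo gC)) (oneTo gR))

  -- Multiplicities in the grids factor over the coordinates; hence each position
  -- occurs at most once, and exactly once inside the box.

  mult-classical : ∀ x y R C → mult (x , y) (classicalGrid R C) ≡ multℕ x (oneTo R) * multℕ y (oneTo C)
  mult-classical x y R C = begin
    mult (x , y) (classicalGrid R C)
      ≡⟨ sumBy-concatMap (λ q → δ₂ q (x , y)) _ (reverse (oneTo R)) ⟩
    sumBy (λ a → mult (x , y) (map (λ b → (a , b)) (oneTo C))) (reverse (oneTo R))
      ≡⟨ sumBy-cong (λ a → trans (sumBy-map (λ q → δ₂ q (x , y)) (λ b → (a , b)) (oneTo C)) (sumBy-*ˡ (λ b → δ b y) (δ a x) (oneTo C)))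
                    (reverse (oneTo R)) ⟩
    sumBy (λ a → δ a x * multℕ y (oneTo C)) (reverse (oneTo R))
      ≡⟨ sumBy-*ʳ (λ a → δ a x) _ (reverse (oneTo R)) ⟩
    sumBy (λ a → δ a x) (reverse (oneTo R)) * multℕ y (oneTo C)
      ≡⟨ cong (_* multℕ y (oneTo C)) (sumBy-reverse (λ a → δ a x) (oneTo R)) ⟩
    multℕ x (oneTo R) * multℕ y (oneTo C) ∎
    where open ≡-Reasoning

  mult-ladder : ∀ x y R C K → mult (x , y) (ladderGrid R C K) ≡ multℕ x (oneTo R) * (multℕ y (oneTo C) * multℕ (key x y) (oneTo K))
  mult-ladder x y R C K = begin
    mult q (ladderGrid R C K)
      ≡⟨ sumBy-concatMap count _ (oneTo K) ⟩
    sumBy (λ k → mult q (concatMap (λ c → concatMap (onLadder k c) (oneTo C)) (oneTo R))) (oneTo K)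
      ≡⟨ sumBy-cong (λ k → trans (sumBy-concatMap count _ (oneTo R))
                                 (sumBy-cong (λ c → trans (sumBy-concatMap count _ (oneTo C)) (column k c)) (oneTo R))) (oneTo K) ⟩
    sumBy (λ k → sumBy (λ c → δ c x * (multℕ y (oneTo C) * δ (key x y) k)) (oneTo R)) (oneTo K)
      ≡⟨ sumBy-cong (λ k → sumBy-*ʳ (λ c → δ c x) _ (oneTo R)) (oneTo K) ⟩
    sumBy (λ k → multℕ x (oneTo R) * (multℕ y (oneTo C) * δ (key x y) k)) (oneTo K)
      ≡⟨ sumBy-*ˡ (λ k → multℕ y (oneTo C) * δ (key x y) k) (multℕ x (oneTo R)) (oneTo K) ⟩
    multℕ x (oneTo R) * sumBy (λ k → multℕ y (oneTo C) * δ (key x y) k) (oneTo K)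
      ≡⟨ cong (multℕ x (oneTo R) *_) (sumBy-*ˡ (δ (key x y)) (multℕ y (oneTo C)) (oneTo K)) ⟩
    multℕ x (oneTo R) * (multℕ y (oneTo C) * sumBy (δ (key x y)) (oneTo K))
      ≡⟨ cong (λ z → multℕ x (oneTo R) * (multℕ y (oneTo C) * z)) (sumBy-cong (δ-sym (key x y)) (oneTo K)) ⟩
    multℕ x (oneTo R) * (multℕ y (oneTo C) * multℕ (key x y) (oneTo K)) ∎
    where
    open ≡-Reasoning
    q = (x , y)
    count = λ p → δ₂ p q
    atPosition : ∀ k c d → mult q (onLadder k c d) ≡ δ c x * (δ d y * δ (key x y) k)
    atPosition k c d with c ≟ x | d ≟ y
    ... | yes refl | yes refl with key c d ≡ᵇ k
    ...   | true  rewrite δ-refl c | δ-refl d = refl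
    ...   | false rewrite δ-refl c | δ-refl d = refl
    atPosition k c d | no c≢x | _ with key c d ≡ᵇ k
    ...   | true  rewrite δ-≢ c≢x = refl
    ...   | false rewrite δ-≢ c≢x = refl
    atPosition k c d | yes refl | no d≢y with key c d ≡ᵇ k
    ...   | true  rewrite δ-≢ d≢y | δ-refl c = refl
    ...   | false rewrite δ-≢ d≢y | δ-refl c = refl
    column : ∀ k c → sumBy (λ d → mult q (onLadder k c d)) (oneTo C) ≡ δ c x * (multℕ y (oneTo C) * δ (key x y) k)
    column k c = trans (sumBy-cong (atPosition k c) (oneTo C))
      (trans (sumBy-*ˡ (λ d → δ d y * δ (key x y) k) (δ c x) (oneTo C))
             (cong (δ c x *_) (sumBy-*ʳ (λ d → δ d y) _ (oneTo C))))

  classicalReading : ∀ B → Reading classicalOrder B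
  classicalReading B = record
    { grid   = classicalGrid B B
    ; reads  = λ μ w l r → trans (signature-entries μ (classicalOrder μ)) (sym (Stable.classical-stable w B B l r))
    ; once   = λ { (x , y) → subst (_≤ 1) (sym (mult-classical x y B B)) (*-mono-≤ (multℕ-oneTo-≤1 x B) (multℕ-oneTo-≤1 y B)) }
    ; covers = λ x y 1≤x x≤B 1≤y y≤B →
        trans (mult-classical x y B B) (cong₂ _*_ (multℕ-oneTo-in x B 1≤x x≤B) (multℕ-oneTo-in y B 1≤y y≤B))
    }

  ladderReading : ∀ B → Reading (ladderOrder ℓ) B
  ladderReading B = record
    { grid   = ladderGrid B B K
    ; reads  = λ μ w l r → trans (signature-entries μ (ladderOrder ℓ μ))
                                 (sym (Stable.ladder-stable w B B K l r (+-mono-≤ l (*-monoʳ-≤ m r))))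
    ; once   = λ { (x , y) → subst (_≤ 1) (sym (mult-ladder x y B B K))
                     (*-mono-≤ (multℕ-oneTo-≤1 x B) (*-mono-≤ (multℕ-oneTo-≤1 y B) (multℕ-oneTo-≤1 (key x y) K))) }
    ; covers = λ x y 1≤x x≤B 1≤y y≤B → trans (mult-ladder x y B B K)
        (cong₂ _*_ (multℕ-oneTo-in x B 1≤x x≤B)
                   (cong₂ _*_ (multℕ-oneTo-in y B 1≤y y≤B)
                              (multℕ-oneTo-in (key x y) K (≤-trans 1≤x (m≤m+n x _)) (+-mono-≤ x≤B (*-monoʳ-≤ m y≤B)))))
    }
    where
    K = B + m * B

  module Agreement (λ′ : Partition) (w : WF λ′) (core : IsCore ℓ λ′) where
    private
      Pc Pl : List Pos
      Pc = pluses (signature ℓ λ′ i (classicalOrder λ′))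
      Pl = pluses (signature ℓ λ′ i (ladderOrder ℓ λ′))

      bound : ℕ
      bound = suc ((length λ′ + row λ′ 1) + (length Pc + length Pl))

      module Classical = OnCore λ′ w core (classicalReading bound)
        (s≤s (+-mono-≤ (m≤m+n (length λ′) (row λ′ 1)) (m≤m+n (length Pc) (length Pl))))
        (s≤s (+-mono-≤ (m≤n+m (row λ′ 1) (length λ′)) (m≤m+n (length Pc) (length Pl))))
      module Ladder = OnCore λ′ w core (ladderReading bound)
        (s≤s (+-mono-≤ (m≤m+n (length λ′) (row λ′ 1)) (m≤n+m (length Pl) (length Pc))))
        (s≤s (+-mono-≤ (m≤n+m (row λ′ 1) (length λ′)) (m≤n+m (length Pl) (length Pc))))

    φ̂≡φ : φ̂ ℓ i λ′ ≡ φ ℓ i λ′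
    φ̂≡φ = trans Ladder.φ-count (sym Classical.φ-count)

    f̂^φ̂≡f̃^φ : f̂ ℓ i ^[ φ̂ ℓ i λ′ ] just λ′ ≡ f̃ ℓ i ^[ φ ℓ i λ′ ] just λ′
    f̂^φ̂≡f̃^φ = trans Ladder.result-reached (trans (cong just same) (sym Classical.result-reached))
      where
      same : Ladder.result ≡ Classical.result
      same = WF-row-ext Ladder.result-WF Classical.result-WF (λ x → trans (Ladder.result-row x) (sym (Classical.result-row x)))

    ladder-fills : ∀ ν → WF ν → (∀ x → row ν x ≡ row λ′ x + growsI λ′ x) → f̂ ℓ i ^[ φ̂ ℓ i λ′ ] just λ′ ≡ just ν
    ladder-fills ν wν rows = trans Ladder.result-reached
      (cong just (WF-row-ext Ladder.result-WF wν (λ x → trans (Ladder.result-row x) (sym (rows x)))))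

pred-+-suc : ∀ {r} → 1 ≤ r → ∀ c → r ∸ 1 + c + 1 ≡ r + c
pred-+-suc {suc r} _ c = trans (+-assoc r c 1) (trans (cong (r +_) (+-comm c 1)) (+-suc r c))

+-pred-suc : ∀ r {c} → 1 ≤ c → r + (c ∸ 1) + 1 ≡ r + c
+-pred-suc r {suc c} _ = trans (+-assoc r c 1) (cong (r +_) (+-comm c 1))

pred-+-pred-suc : ∀ {r c} → 1 ≤ r → 1 ≤ c → r ∸ 1 + (c ∸ 1) + 1 + 1 ≡ r + c
pred-+-pred-suc {suc r} {suc c} _ _ = +-*-Solver.solve 2 (λ r c → r :+ c :+ con 1 :+ con 1 := (con 1 :+ r) :+ (con 1 :+ c)) refl r c
  where open +-*-Solver using (_:+_; _:=_; con)

-- Removing from a nonempty ℓ-core λ all removable i-boxes, where i is the residue of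
-- the last box of the last row, gives a smaller ℓ-core μ whose addable i-boxes are
-- exactly the removed boxes; hence λ = f̂_i^φ̂ μ.
module Removal (m : ℕ) (1≤m : 1 ≤ m) (λ′ : Partition) (w : WF λ′) (core : IsCore (suc m) λ′)
               (nonempty : 1 ≤ length λ′) where
  open Residues m

  n : ℕ
  n = length λ′

  i : ℕ
  i = res ℓ n (row λ′ n)

  open Signatures m 1≤m i

  last-removable : RemI λ′ (n , row λ′ n)
  last-removable = ⇒removable λ′ n nonempty (row-positive w n nonempty ≤-refl)
                     (subst (_< row λ′ n) (sym (row-beyond λ′ (suc n) ≤-refl)) (row-positive w n nonempty ≤-refl))
                 , refl

  drop : ℕ → ℕ
  drop x = if removable λ′ x (row λ′ x) ∧ (res ℓ x (row λ′ x) ≡ᵇ i) then 1 else 0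

  drop-cases : ∀ x → (drop x ≡ 1 × RemI λ′ (x , row λ′ x)) ⊎ (drop x ≡ 0 × ¬ RemI λ′ (x , row λ′ x))
  drop-cases x with removable λ′ x (row λ′ x) in rem | res ℓ x (row λ′ x) ≡ᵇ i in r
  ... | true  | true  = inj₁ (refl , refl , ≡ᵇ⇒≡′ r)
  ... | true  | false = inj₂ (refl , λ { (_ , r≡i) → subst (λ z → z ≡ false → ⊥) (trans (sym (≡ᵇ-refl i)) (cong (_≡ᵇ i) (sym r≡i))) (λ ()) r })
  ... | false | _     = inj₂ (refl , λ { (() , _) })

  drop≤1 : ∀ x → drop x ≤ 1
  drop≤1 x with drop-cases x
  ... | inj₁ (e , _) = ≤-reflexive e
  ... | inj₂ (e , _) = subst (_≤ 1) (sym e) z≤n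

  shrunk : ℕ → ℕ
  shrunk x = row λ′ x ∸ drop x

  shrunk≤ : ∀ x → shrunk x ≤ row λ′ x
  shrunk≤ x = m∸n≤m (row λ′ x) (drop x)

  interlace : ∀ x → 1 ≤ x → row λ′ (suc x) ≤ shrunk x
  interlace x 1≤x with drop-cases x
  ... | inj₁ (d≡1 , rem , _) rewrite d≡1 = ∸-monoˡ-≤ 1 (proj₂ (proj₂ (proj₂ (removable⇒ λ′ x _ rem))))
  ... | inj₂ (d≡0 , _)       rewrite d≡0 = row-antitone w x (suc x) 1≤x (n≤1+n x)

  private
    module μ-rows = FromRows shrunk n (cong (_∸ drop 0) (row-zero λ′))
      (λ x n<x → trans (cong (_∸ drop x) (row-beyond λ′ x n<x)) (0∸n≡0 (drop x)))
      (λ x 1≤x → ≤-trans (shrunk≤ (suc x)) (interlace x 1≤x))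

  μ : Partition
  μ = fromRows shrunk n

  μ-WF : WF μ
  μ-WF = μ-rows.fromRows-WF

  μ-row : ∀ x → row μ x ≡ row λ′ x ∸ drop x
  μ-row = μ-rows.fromRows-row

  μ-smaller : size μ < size λ′
  μ-smaller = begin-strict
    size μ                                                  ≡⟨ sym (size-over μ n μ-rows.fromRows-length) ⟩
    sumBy (row μ) (oneTo n)                                 ≡⟨ cong (λ k → sumBy (row μ) (oneTo k)) (sym n≡) ⟩
    sumBy (row μ) (oneTo (suc (n ∸ 1)))                     ≡⟨ sumBy-oneTo-snoc (row μ) (n ∸ 1) ⟩
    sumBy (row μ) (oneTo (n ∸ 1)) + (row μ (suc (n ∸ 1)) + 0)
      <⟨ +-mono-≤-< (sumBy-mono (λ x → ≤-trans (≤-reflexive (μ-row x)) (shrunk≤ x)) (oneTo (n ∸ 1))) (+-monoˡ-< 0 lastShorter) ⟩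
    sumBy (row λ′) (oneTo (n ∸ 1)) + (row λ′ (suc (n ∸ 1)) + 0) ≡⟨ sym (sumBy-oneTo-snoc (row λ′) (n ∸ 1)) ⟩
    sumBy (row λ′) (oneTo (suc (n ∸ 1)))                    ≡⟨ cong (λ k → sumBy (row λ′) (oneTo k)) n≡ ⟩
    size λ′                                                 ∎
    where
    open ≤-Reasoning
    n≡ : suc (n ∸ 1) ≡ n
    n≡ = m+[n∸m]≡n nonempty
    lastShorter : row μ (suc (n ∸ 1)) < row λ′ (suc (n ∸ 1))
    lastShorter rewrite n≡ | μ-row n with drop-cases n
    ... | inj₂ (_ , notRem)  = ⊥-elim (notRem last-removable)
    ... | inj₁ (d≡1 , _)     rewrite d≡1 = ∸-monoʳ-< {o = 0} (s≤s z≤n) (row-positive w n nonempty ≤-refl)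

  -- μ is again an ℓ-core: a box of μ with hook length divisible by ℓ would produce
  -- such a box in λ, or a removable i-box of λ that was not removed, or 1 ≈ 0.
  module NoDivisibleHook (a b : ℕ) (inμ : inDiag μ a b ≡ true) (ℓ∣ : ℓ ∣ hook μ a b) where
    1≤a : 1 ≤ a
    1≤a = proj₁ (inDiag⇒ μ a b inμ)

    1≤b : 1 ≤ b
    1≤b = proj₁ (proj₂ (inDiag⇒ μ a b inμ))

    b≤μa : b ≤ row μ a
    b≤μa = proj₂ (proj₂ (inDiag⇒ μ a b inμ))

    R c : ℕ
    R = row λ′ a
    c = col λ′ b

    b≤R : b ≤ R
    b≤R = ≤-trans b≤μa (≤-trans (≤-reflexive (μ-row a)) (shrunk≤ a))

    1≤R : 1 ≤ R
    1≤R = ≤-trans 1≤b b≤R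

    a≤c : a ≤ c
    a≤c = box⇒≤col w a b 1≤a 1≤b b≤R

    1≤c : 1 ≤ c
    1≤c = ≤-trans 1≤a a≤c

    b≤λc : b ≤ row λ′ c
    b≤λc with proj₁ (col-spec w b 1≤b)
    ... | inj₁ c≡0 = ⊥-elim (<⇒≱ 1≤c (≤-reflexive c≡0))
    ... | inj₂ le  = le

    λc+1<b : row λ′ (suc c) < b
    λc+1<b = proj₂ (col-spec w b 1≤b)

    hookμ : ∀ {u v} → row μ a ≡ u → col μ b ≡ v → u + v + 1 ≈ b + a
    hookμ refl refl = hook-∣⇒≈ μ a b b≤μa (box⇒≤col μ-WF a b 1≤a 1≤b b≤μa) ℓ∣

    rowμa : ∀ {d} → drop a ≡ d → row μ a ≡ R ∸ d
    rowμa d≡ = trans (μ-row a) (cong (R ∸_) d≡)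

    col-kept : ¬ (b ≡ row λ′ c × drop c ≡ 1) → col μ b ≡ c
    col-kept notBottom = col-unique μ-WF c b 1≤b (inj₂ reach) (≤-<-trans μc+1≤ λc+1<b)
      where
      μc+1≤ : row μ (suc c) ≤ row λ′ (suc c)
      μc+1≤ = ≤-trans (≤-reflexive (μ-row (suc c))) (shrunk≤ (suc c))
      reach : b ≤ row μ c
      reach with drop c ≟ 0
      ... | yes d≡0 = subst (b ≤_) (sym (trans (μ-row c) (cong (row λ′ c ∸_) d≡0))) b≤λc
      ... | no  d≢0 with b ≟ row λ′ c
      ...   | yes b≡ = ⊥-elim (notBottom (b≡ , d≡1))
        where
        d≡1 : drop c ≡ 1
        d≡1 with drop-cases c
        ... | inj₁ (e , _) = e
        ... | inj₂ (e , _) = ⊥-elim (d≢0 e)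
      ...   | no  b≢ = ≤-trans (∸-monoˡ-≤ 1 (≤∧≢⇒< b≤λc b≢))
                         (≤-trans (∸-monoʳ-≤ (row λ′ c) (drop≤1 c)) (≤-reflexive (sym (μ-row c))))

    col-dropped : b ≡ row λ′ c → drop c ≡ 1 → col μ b ≡ c ∸ 1
    col-dropped b≡ d≡1 = col-unique μ-WF (c ∸ 1) b 1≤b reach (subst (λ z → row μ z < b) (sym c≡) μc<b)
      where
      c≡ : suc (c ∸ 1) ≡ c
      c≡ = m+[n∸m]≡n 1≤c
      μc<b : row μ c < b
      μc<b rewrite μ-row c | d≡1 | sym b≡ = ∸-monoʳ-< {o = 0} (s≤s z≤n) 1≤b
      reach : c ∸ 1 ≡ 0 ⊎ b ≤ row μ (c ∸ 1)
      reach with c ∸ 1 ≟ 0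
      ... | yes c-1≡0 = inj₁ c-1≡0
      ... | no  c-1≢0 = inj₂ (subst₂ _≤_ (trans (cong (row λ′) c≡) (sym b≡)) (sym (μ-row (c ∸ 1)))
                                      (interlace (c ∸ 1) (n≢0⇒n>0 c-1≢0)))

    same-residue : R + c ≈ b + a → res ℓ a R ≡ res ℓ c b
    same-residue = ≈⇒res a R c b

    -- Row a and column b both kept: the hook of (a , b) in λ is divisible by ℓ.
    both-kept : drop a ≡ 0 → col μ b ≡ c → ⊥
    both-kept d≡0 kept = core a b (⇒inDiag λ′ a b 1≤a 1≤b b≤R) (≈⇒hook-∣ λ′ a b b≤R a≤c (hookμ (rowμa d≡0) kept))

    -- Row a shortened, column b kept and b not its bottom: look at the box (a , b + 1) of λ.
    row-shortened : drop a ≡ 1 → col μ b ≡ c → b ≢ row λ′ c → ⊥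
    row-shortened d≡1 kept b≢ = core a (suc b) (⇒inDiag λ′ a (suc b) 1≤a (s≤s z≤n) b+1≤R)
                                     (≈⇒hook-∣ λ′ a (suc b) b+1≤R (subst (a ≤_) (sym col-b+1) a≤c) hookλ)
      where
      b+1≤R : suc b ≤ R
      b+1≤R = subst (suc b ≤_) (m+[n∸m]≡n 1≤R) (s≤s (subst (b ≤_) (rowμa d≡1) b≤μa))
      col-b+1 : col λ′ (suc b) ≡ c
      col-b+1 = col-unique w c (suc b) (s≤s z≤n) (inj₂ (≤∧≢⇒< b≤λc b≢)) (<-trans λc+1<b (n<1+n b))
      hookλ : R + col λ′ (suc b) + 1 ≈ suc b + a
      hookλ = subst₂ _≈_ (trans (cong (_+ 1) (pred-+-suc 1≤R c)) (cong (λ z → R + z + 1) (sym col-b+1))) (+-comm (b + a) 1)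
                (≈-+ʳ (R ∸ 1 + c + 1) (b + a) 1 (hookμ (rowμa d≡1) kept))

    -- Row a shortened, column b kept although b is its bottom: the end (c , b) of
    -- row c has residue i and is removable, so it would have been removed.
    bottom-kept : RemI λ′ (a , R) → drop a ≡ 1 → col μ b ≡ c → b ≡ row λ′ c → ¬ RemI λ′ (c , row λ′ c) → ⊥
    bottom-kept (_ , resA) d≡1 kept b≡ notRem = notRem
      ( ⇒removable λ′ c 1≤c (subst (1 ≤_) b≡ 1≤b) (subst (row λ′ (suc c) <_) b≡ λc+1<b)
      , trans (cong (res ℓ c) (sym b≡)) (trans (sym (same-residue (subst (_≈ b + a) (pred-+-suc 1≤R c) (hookμ (rowμa d≡1) kept)))) resA))

    -- Row a kept, column b shortened: the end of row a has residue i, so either it is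
    -- removable (and would have been removed) or the box (a + 1 , b) of λ has a hook
    -- divisible by ℓ.
    column-shortened : drop a ≡ 0 → ¬ RemI λ′ (a , R) → b ≡ row λ′ c → drop c ≡ 1 → RemI λ′ (c , row λ′ c) → ⊥
    column-shortened d≡0 notRem b≡ dc≡1 (_ , resC) = decide (row λ′ (suc a) <? R)
      where
      dropped : col μ b ≡ c ∸ 1
      dropped = col-dropped b≡ dc≡1
      a<c : suc a ≤ c
      a<c = subst (suc a ≤_) (m+[n∸m]≡n 1≤c) (s≤s (subst (a ≤_) dropped (box⇒≤col μ-WF a b 1≤a 1≤b b≤μa)))
      R+c≈ : R + c ≈ b + a
      R+c≈ = subst (_≈ b + a) (+-pred-suc R 1≤c) (hookμ (rowμa d≡0) dropped)
      resA : res ℓ a R ≡ i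
      resA = trans (same-residue R+c≈) (trans (cong (res ℓ c) b≡) resC)
      decide : Dec (row λ′ (suc a) < R) → ⊥
      decide (yes shorter)    = notRem (⇒removable λ′ a 1≤a 1≤R shorter , resA)
      decide (no  notShorter) = core (suc a) b (⇒inDiag λ′ (suc a) b (s≤s z≤n) 1≤b b≤λa+1) (≈⇒hook-∣ λ′ (suc a) b b≤λa+1 a<c hookλ)
        where
        λa+1≡R : row λ′ (suc a) ≡ R
        λa+1≡R = ≤-antisym (row-antitone w a (suc a) 1≤a (n≤1+n a)) (≮⇒≥ notShorter)
        b≤λa+1 : b ≤ row λ′ (suc a)
        b≤λa+1 = subst (b ≤_) (sym λa+1≡R) b≤R
        hookλ : row λ′ (suc a) + c + 1 ≈ b + suc a
        hookλ = subst₂ _≈_ (cong (λ z → z + c + 1) (sym λa+1≡R)) (trans (+-comm (b + a) 1) (sym (+-suc b a)))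
                  (≈-+ʳ (R + c) (b + a) 1 R+c≈)

    -- Row a and column b both shortened: R + c ≈ b + a by the residues, but the hook
    -- condition gives R + c ≈ b + a + 1, so 1 ≈ 0.
    both-shortened : RemI λ′ (a , R) → drop a ≡ 1 → b ≡ row λ′ c → drop c ≡ 1 → RemI λ′ (c , row λ′ c) → ⊥
    both-shortened (_ , resA) d≡1 b≡ dc≡1 (_ , resC) = 1≉0 1≤m (≈-cancelʳ 1 0 (b + a) (trans (sym viaHook) viaResidues))
      where
      viaResidues : R + c ≈ b + a
      viaResidues = res⇒≈ a R c b (trans resA (trans (sym resC) (cong (res ℓ c) (sym b≡))))
      viaHook : R + c ≈ 1 + (b + a)
      viaHook = subst₂ _≈_ (pred-+-pred-suc 1≤R 1≤c) (+-comm (b + a) 1)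
                  (≈-+ʳ (R ∸ 1 + (c ∸ 1) + 1) (b + a) 1 (hookμ (rowμa d≡1) (col-dropped b≡ dc≡1)))

    contradiction : ⊥
    contradiction with drop-cases a | b ≟ row λ′ c | drop-cases c
    ... | inj₂ (da , notRemA) | yes b≡ | inj₁ (dc , remC)    = column-shortened da notRemA b≡ dc remC
    ... | inj₂ (da , _)       | yes b≡ | inj₂ (dc , _)       = both-kept da (col-kept (λ (_ , dc≡1) → 0≢1+n (trans (sym dc) dc≡1)))
    ... | inj₂ (da , _)       | no  b≢ | _                   = both-kept da (col-kept (λ (b≡ , _) → b≢ b≡))
    ... | inj₁ (da , remA)    | yes b≡ | inj₁ (dc , remC)    = both-shortened remA da b≡ dc remC
    ... | inj₁ (da , remA)    | yes b≡ | inj₂ (dc , notRemC) =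
      bottom-kept remA da (col-kept (λ (_ , dc≡1) → 0≢1+n (trans (sym dc) dc≡1))) b≡ notRemC
    ... | inj₁ (da , _)       | no  b≢ | _                   = row-shortened da (col-kept (λ (b≡ , _) → b≢ b≡)) b≢

  μ-core : IsCore ℓ μ
  μ-core a b inμ ℓ∣ = NoDivisibleHook.contradiction a b inμ ℓ∣

  -- The addable i-boxes of μ are exactly the removed boxes: a removed box is
  -- addable again, and any other addable i-box of μ would be one of λ, next to
  -- the removable i-box at the end of row n.
  μ-growsI : ∀ x → growsI μ x ≡ drop x
  μ-growsI x with drop-cases x
  ... | inj₁ (d≡1 , rem , resX) = trans (isAddI-AddI μ (x , suc (row μ x)) (add , subst (λ z → res ℓ x z ≡ i) (sym end) resX)) (sym d≡1)
    where
    R = row λ′ x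
    1≤x : 1 ≤ x
    1≤x = proj₁ (removable⇒ λ′ x R rem)
    1≤R : 1 ≤ R
    1≤R = proj₁ (proj₂ (removable⇒ λ′ x R rem))
    end : suc (row μ x) ≡ R
    end = trans (cong suc (trans (μ-row x) (cong (R ∸_) d≡1))) (m+[n∸m]≡n 1≤R)
    grow : CanGrow μ x
    grow with x ≟ 1
    ... | yes x≡1 = inj₁ x≡1
    ... | no  x≢1 = inj₂ (subst₂ _≤_ (trans (cong (row λ′) x-1+1) (sym end)) (sym (μ-row (x ∸ 1)))
                            (interlace (x ∸ 1) (∸-monoˡ-≤ 1 (≤∧≢⇒< 1≤x (λ e → x≢1 (sym e))))))
      where
      x-1+1 : suc (x ∸ 1) ≡ x
      x-1+1 = m+[n∸m]≡n 1≤x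
    add : addable μ x (suc (row μ x)) ≡ true
    add = ⇒addable μ x 1≤x grow
  ... | inj₂ (d≡0 , _) with isAddI-cases μ (x , suc (row μ x))
  ...   | inj₁ none = trans none (sym d≡0)
  ...   | inj₂ (_ , add , resX) =
    ⊥-elim (core-addable-removable m 1≤m w core x (suc (row λ′ x)) n (row λ′ n) addλ (proj₁ last-removable)
              (trans (subst (λ z → res ℓ x (suc z) ≡ i) same resX) (sym (proj₂ last-removable))))
    where
    same : row μ x ≡ row λ′ x
    same = trans (μ-row x) (cong (row λ′ x ∸_) d≡0)
    growλ : CanGrow μ x → CanGrow λ′ x
    growλ (inj₁ x≡1) = inj₁ x≡1
    growλ (inj₂ le)  = inj₂ (subst (λ z → suc z ≤ row λ′ (x ∸ 1)) same
                               (≤-trans le (≤-trans (≤-reflexive (μ-row (x ∸ 1))) (shrunk≤ (x ∸ 1)))))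
    addλ : addable λ′ x (suc (row λ′ x)) ≡ true
    addλ = ⇒addable λ′ x (proj₁ (addable⇒ μ x (suc (row μ x)) add)) (growλ (proj₂ (proj₂ (addable⇒ μ x (suc (row μ x)) add))))

  λ-from-μ : f̂ ℓ i ^[ φ̂ ℓ i μ ] just μ ≡ just λ′
  λ-from-μ = Agreement.ladder-fills μ μ-WF μ-core λ′ w restore
    where
    drop≤row : ∀ x → drop x ≤ row λ′ x
    drop≤row x with drop-cases x
    ... | inj₁ (d≡1 , rem , _) = subst (_≤ row λ′ x) (sym d≡1) (proj₁ (proj₂ (removable⇒ λ′ x _ rem)))
    ... | inj₂ (d≡0 , _)       = subst (_≤ row λ′ x) (sym d≡0) z≤n
    restore : ∀ x → row λ′ x ≡ row μ x + growsI μ x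
    restore x = sym (trans (cong₂ _+_ (μ-row x) (μ-growsI x)) (m∸n+n≡m (drop≤row x)))

applyF̂-++ : ∀ ℓ xs ys mb → applyF̂ ℓ (xs ++ ys) mb ≡ applyF̂ ℓ ys (applyF̂ ℓ xs mb)
applyF̂-++ ℓ []       ys mb = refl
applyF̂-++ ℓ (x ∷ xs) ys mb = applyF̂-++ ℓ xs ys (mb >>= f̂ ℓ x)

applyF̂-replicate : ∀ ℓ n j mb → applyF̂ ℓ (replicate n j) mb ≡ f̂ ℓ j ^[ n ] mb
applyF̂-replicate ℓ zero    j mb = refl
applyF̂-replicate ℓ (suc n) j mb = applyF̂-replicate ℓ n j (mb >>= f̂ ℓ j)

cores-are-nodes : ∀ m → 1 ≤ m → ∀ λ′ → WF λ′ → IsCore (suc m) λ′ → NodeBL (suc m) λ′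
cores-are-nodes m 1≤m λ′ w core = below (suc (size λ′)) λ′ ≤-refl w core
  where
  below : ∀ k λ′ → size λ′ < k → WF λ′ → IsCore (suc m) λ′ → NodeBL (suc m) λ′
  below (suc k) []          _     _ _    = [] , [] , refl
  below (suc k) λ′@(_ ∷ _) small w core =
    word ++ replicate (φ̂ (suc m) i μ) i , ++⁺ letters (replicate⁺ _ (Residues.res<ℓ m n (row λ′ n))) , reaches
    where
    open Removal m 1≤m λ′ w core (s≤s z≤n) using (n; i; μ; μ-WF; μ-core; μ-smaller; λ-from-μ)
    IH = below k μ (<-≤-trans μ-smaller (≤-pred small)) μ-WF μ-core
    word = proj₁ IH
    letters = proj₁ (proj₂ IH)
    reaches : applyF̂ (suc m) (word ++ replicate (φ̂ (suc m) i μ) i) (just []) ≡ just λ′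
    reaches = begin
      applyF̂ (suc m) (word ++ replicate (φ̂ (suc m) i μ) i) (just [])
        ≡⟨ applyF̂-++ (suc m) word _ (just []) ⟩
      applyF̂ (suc m) (replicate (φ̂ (suc m) i μ) i) (applyF̂ (suc m) word (just []))
        ≡⟨ cong (applyF̂ (suc m) (replicate (φ̂ (suc m) i μ) i)) (proj₂ (proj₂ IH)) ⟩
      applyF̂ (suc m) (replicate (φ̂ (suc m) i μ) i) (just μ)
        ≡⟨ applyF̂-replicate (suc m) (φ̂ (suc m) i μ) i (just μ) ⟩
      f̂ (suc m) i ^[ φ̂ (suc m) i μ ] just μ
        ≡⟨ λ-from-μ ⟩
      just λ′ ∎
      where open ≡-Reasoning

lemma8p1 : (ℓ : ℕ) → 3 ≤ ℓ → (λ′ : Partition) → IsPartition λ′ → IsCore ℓ λ′ →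
    ((i : ℕ) → i < ℓ →
      (φ̂ ℓ i λ′ ≡ φ ℓ i λ′)
      × (f̂ ℓ i ^[ φ̂ ℓ i λ′ ] just λ′ ≡ f̃ ℓ i ^[ φ ℓ i λ′ ] just λ′))
    × NodeBL ℓ λ′
lemma8p1 (suc m) (s≤s 2≤m) λ′ isPartition core =
  (λ i _ → let open Signatures.Agreement m 1≤m i λ′ w core in φ̂≡φ , f̂^φ̂≡f̃^φ) ,
  cores-are-nodes m 1≤m λ′ w core
  where
  1≤m : 1 ≤ m
  1≤m = ≤-trans (s≤s z≤n) 2≤m
  w : WF λ′
  w = IsPartition⇒WF λ′ isPartition
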